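{- Let $\mathcal{P}_1,\ldots,\mathcal{P}_m\subset\mathbb{R}^N$ be lattice polytopes and for each $i$ let $n_i$ be a positive integer with $n_i\ge\dim(\mathcal{P}_i)$. Then: (1) $n_1\mathcal{P}_1+\cdots+n_m\mathcal{P}_m$ has the integer decomposition property; (2) $n_1\mathcal{P}_1*\cdots*n_m\mathcal{P}_m$ has the integer decomposition property if and only if the tuple $(n_1\mathcal{P}_1,\ldots,n_m\mathcal{P}_m)$ is IDP.
   Context: A lattice polytope is a convex polytope with vertices in $\mathbb{Z}^N$; $n\mathcal{P}=\{n\mathbf{x}:\mathbf{x}\in\mathcal{P}\}$ and sums of sets are Minkowski sums. A lattice polytope $\mathcal{P}\subset\mathbb{R}^k$ has the integer decomposition property if for every integer $n\ge1$, $n\mathcal{P}\cap\mathbb{Z}^k=((n-1)\mathcal{P}\cap\mathbb{Z}^k)+(\mathcal{P}\cap\mathbb{Z}^k)$. The Cayley sum is $\mathcal{Q}_1*\cdots*\mathcal{Q}_m=\mathrm{conv}(\{\mathbf{e}_1\}\times\mathcal{Q}_1\cup\cdots\cup\{\mathbf{e}_m\}\times\mathcal{Q}_m)\subset\mathbb{R}^m\times\mathbb{R}^N$, with $\mathbf{e}_i$ the standard unit vectors of $\mathbb{R}^m$. A tuple $(\mathcal{Q}_1,\ldots,\mathcal{Q}_m)$ of lattice polytopes in $\mathbb{R}^N$ is IDP if for every nonempty $I\subset\{1,\ldots,m\}$, $(\sum_{i\in I}\mathcal{Q}_i)\cap\mathbb{Z}^N=\sum_{i\in I}(\mathcal{Q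}_i\cap\mathbb{Z}^N)$.
   Formalization: Points of the lattice polytopes, their dilates and their Minkowski and Cayley sums have rational coordinates, lying in ℚ^N and ℚ^(m+N) rather than $\mathbb{R}^N$ and $\mathbb{R}^m\times\mathbb{R}^N$. -}

module Defs where

open import Level using (0ℓ)
open import Data.Nat as ℕ using (ℕ; zero; suc)
open import Data.Integer as ℤ using (ℤ)
open import Data.Rational as ℚ using (ℚ; 0ℚ; 1ℚ)
open import Data.Fin using (Fin; zero; suc; _≟_)
open import Data.Bool using (Bool; T; not)
open import Data.List using (List)
open import Data.List.Membership.Propositional using (_∈_)
open import Data.Vec.Functional using (_++_)
open import Data.Product using (Σ; ∃; ∃-syntax; _×_; _,_)
open import Relation.Binary.PropositionalEquality using (_≡_)
open import Relation.Nullary using (yes; no)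
open import Function.Bundles using (_⇔_)

-- Points of ℚ^d and ℤ^d (ℚ stands in for ℝ: all polytopes here are
-- rational, and all notions below only involve rational data).

Vecℚ : ℕ → Set
Vecℚ d = Fin d → ℚ

Vecℤ : ℕ → Set
Vecℤ d = Fin d → ℤ

toℚ : ∀ {d} → Vecℤ d → Vecℚ d
toℚ z k = z k ℚ./ 1

ℕtoℚ : ℕ → ℚ
ℕtoℚ n = ℤ.+ n ℚ./ 1

_≈ᵥ_ : ∀ {d} → Vecℚ d → Vecℚ d → Set
x ≈ᵥ y = ∀ k → x k ≡ y k

_≈ᶻ_ : ∀ {d} → Vecℤ d → Vecℤ d → Set
x ≈ᶻ y = ∀ k → x k ≡ y k

0ᵥ : ∀ {d} → Vecℚ d
0ᵥ _ = 0ℚ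

0ᶻ : ∀ {d} → Vecℤ d
0ᶻ _ = ℤ.+ 0

_+ᵥ_ : ∀ {d} → Vecℚ d → Vecℚ d → Vecℚ d
(x +ᵥ y) k = x k ℚ.+ y k

_+ᶻ_ : ∀ {d} → Vecℤ d → Vecℤ d → Vecℤ d
(x +ᶻ y) k = x k ℤ.+ y k

_·ᵥ_ : ∀ {d} → ℚ → Vecℚ d → Vecℚ d
(c ·ᵥ x) k = c ℚ.* x k

sumℚ : ∀ {k} → (Fin k → ℚ) → ℚ
sumℚ {zero} f = 0ℚ
sumℚ {suc k} f = f zero ℚ.+ sumℚ (λ j → f (suc j))

sumᵥ : ∀ {k d} → (Fin k → Vecℚ d) → Vecℚ d
sumᵥ {zero} f = 0ᵥ
sumᵥ {suc k} f = f zero +ᵥ sumᵥ (λ j → f (suc j))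

sumᶻ : ∀ {k d} → (Fin k → Vecℤ d) → Vecℤ d
sumᶻ {zero} f = 0ᶻ
sumᶻ {suc k} f = f zero +ᶻ sumᶻ (λ j → f (suc j))

Subset : ℕ → Set₁
Subset d = Vecℚ d → Set

Conv : ∀ {d} → Subset d → Subset d
Conv {d} S x =
  ∃[ k ] Σ (Fin k → Vecℚ d) λ p → Σ (Fin k → ℚ) λ λs →
    (∀ j → S (p j)) × (∀ j → 0ℚ ℚ.≤ λs j) × (sumℚ λs ≡ 1ℚ) ×
    (x ≈ᵥ sumᵥ (λ j → λs j ·ᵥ p j))

LatticePolytope : ∀ {d} → List (Vecℤ d) → Subset d
LatticePolytope {d} V = Conv (λ x → ∃[ v ] (v ∈ V × x ≈ᵥ toℚ v))

_⊙_ : ∀ {d} → ℕ → Subset d → Subset d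
(n ⊙ S) x = ∃[ y ] (S y × x ≈ᵥ (ℕtoℚ n ·ᵥ y))

_⊕_ : ∀ {d} → Subset d → Subset d → Subset d
(S ⊕ T) x = ∃[ a ] ∃[ b ] (S a × T b × x ≈ᵥ (a +ᵥ b))

-- Minkowski sum  Σ_{i ∈ I} Q_i  of a family over the index set I ⊆ Fin m
-- (I given by its indicator); the empty sum is {0}.
MinkSumOver : ∀ {m d} → (Fin m → Bool) → (Fin m → Subset d) → Subset d
MinkSumOver {m} {d} I Q x =
  Σ (Fin m → Vecℚ d) λ a →
    (∀ i → T (I i) → Q i (a i)) × (∀ i → T (not (I i)) → a i ≈ᵥ 0ᵥ) ×
    (x ≈ᵥ sumᵥ a)

MinkSum : ∀ {m d} → (Fin m → Subset d) → Subset d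
MinkSum Q = MinkSumOver (λ _ → Data.Bool.true) Q

LatPts : ∀ {d} → Subset d → Vecℤ d → Set
LatPts S z = S (toℚ z)

IDP : ∀ {d} → Subset d → Set
IDP {d} P = ∀ (n : ℕ) → 1 ℕ.≤ n → ∀ (z : Vecℤ d) →
  LatPts (n ⊙ P) z ⇔
    (∃[ a ] ∃[ b ] (LatPts ((n ℕ.∸ 1) ⊙ P) a × LatPts P b × z ≈ᶻ (a +ᶻ b)))

TupleIDP : ∀ {m d} → (Fin m → Subset d) → Set
TupleIDP {m} {d} Q = ∀ (I : Fin m → Bool) → (∃[ i ] T (I i)) → ∀ (z : Vecℤ d) →
  LatPts (MinkSumOver I Q) z ⇔
    (Σ (Fin m → Vecℤ d) λ b →
      (∀ i → T (I i) → LatPts (Q i) (b i)) × (∀ i → T (not (I i)) → b i ≈ᶻ 0ᶻ) ×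
      (z ≈ᶻ sumᶻ b))

-- Cayley sum  Q_1 * ⋯ * Q_m = conv(⋃_i {e_i} × Q_i) ⊆ ℚ^m × ℚ^d ≅ ℚ^(m+d)

unitVec : ∀ {m} → Fin m → Vecℚ m
unitVec i j with i ≟ j
... | yes _ = 1ℚ
... | no _ = 0ℚ

Cayley : ∀ {m d} → (Fin m → Subset d) → Subset (m ℕ.+ d)
Cayley {m} {d} Q = Conv (λ x → ∃[ i ] ∃[ q ] (Q i q × x ≈ᵥ (unitVec i ++ q)))

AffinelyIndependent : ∀ {k d} → (Fin k → Vecℚ d) → Set
AffinelyIndependent {k} p = ∀ (λs : Fin k → ℚ) → sumℚ λs ≡ 0ℚ →
  sumᵥ (λ j → λs j ·ᵥ p j) ≈ᵥ 0ᵥ → ∀ j → λs j ≡ 0ℚ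

-- dim S ≤ n : every affinely independent family of points of S has at
-- most n+1 members (dim S = max #aff. indep. points in S − 1).
DimAtMost : ∀ {d} → Subset d → ℕ → Set
DimAtMost {d} S n = ∀ (k : ℕ) (p : Fin k → Vecℚ d) → (∀ j → S (p j)) →
  AffinelyIndependent p → k ℕ.≤ suc n

-- Points of dilates are written as nonnegative combinations of the listed lattice points. For
-- n ≥ dim P, Carathéodory's theorem writes a point of (c+1)nP with at most n + 1 of them; their
-- fractional weights then have mass below n + 1, so integral weights of mass cn can be split off:
-- x = y + r with y ∈ nP and r a lattice point of cnP. Doing this in every summand of a
-- Minkowski sum gives (1). A lattice point of s(Q₁ * ⋯ * Qₘ) is a pair (a, z) with a ∈ ℕᵐ,
-- Σ a = s and z ∈ Σ aᵢQᵢ. If the Cayley sum is IDP, splitting off lattice points (eⱼ, q) of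
-- Q₁ * ⋯ * Qₘ one at a time decomposes the lattice points of Σ_{i ∈ I} Qᵢ. Conversely, peeling
-- every aᵢQᵢ as above leaves a lattice point of Σ_{aᵢ > 0} Qᵢ, and the tuple IDP splits it into
-- lattice points bᵢ ∈ Qᵢ; then (eⱼ, bⱼ) is the lattice point of Q₁ * ⋯ * Qₘ to split off.

module Submission where

open import Defs
import Algebra.Properties.Semiring.Sum
open import Data.Bool using (Bool; true; false; T; not)
open import Data.Empty using (⊥; ⊥-elim)
open import Data.Fin using (Fin; zero; suc; punchIn; punchOut; splitAt; _↑ˡ_; _↑ʳ_; _≟_)
open import Data.Fin.Properties using (all?; ¬∀⟶∃¬)
import Data.Fin.Properties as FinP
open import Data.Integer as ℤ using (ℤ)
import Data.Integer.Properties as ℤP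
import Data.Integer.Solver
open import Data.List using (List)
open import Data.List.Membership.Propositional using (_∈_)
open import Data.Nat as ℕ using (ℕ; zero; suc)
import Data.Nat.Coprimality as Coprime
import Data.Nat.DivMod as DivMod
import Data.Nat.Properties as ℕP
open import Data.Product using (Σ; ∃; ∃-syntax; _×_; _,_; proj₁; proj₂; map₁; map₂; uncurry)
open import Data.Rational as ℚ using (ℚ; 0ℚ; 1ℚ; mkℚ; _/_; _+_; _*_; -_; _≤_; _<_)
import Data.Rational.Properties as ℚP
import Data.Rational.Solver
import Data.Rational.Unnormalised as ℚᵘ
import Data.Rational.Unnormalised.Properties as ℚᵘP
open import Data.Sum using (_⊎_; inj₁; inj₂)
open import Data.Unit using (tt)
open import Data.Vec.Functional using (_++_; take; drop; insertAt; updateAt; removeAt)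
open import Data.Vec.Functional.Properties
  using (lookup-++ˡ; lookup-++ʳ; insertAt-lookup; insertAt-punchIn; updateAt-updates; updateAt-minimal)
open import Function using (_∘_)
open import Function.Bundles using (_⇔_; mk⇔; Equivalence)
open import Relation.Binary.Definitions using (tri<; tri≈; tri>)
open import Relation.Binary.PropositionalEquality
open import Relation.Nullary using (Dec; yes; no; ¬_)

open Algebra.Properties.Semiring.Sum ℕP.+-*-semiring
  using (sum-remove; sum-cong-≗; sum-replicate-zero) renaming (sum to sumℕ)
open Data.Rational.Solver.+-*-Solver using (solve; _:+_; _:*_; _:=_; :-_; con)
module ℤSolver = Data.Integer.Solver.+-*-Solver

≈ᵥ-sym : ∀ {d} {x y : Vecℚ d} → x ≈ᵥ y → y ≈ᵥ x
≈ᵥ-sym e k = sym (e k)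

≈ᵥ-trans : ∀ {d} {x y z : Vecℚ d} → x ≈ᵥ y → y ≈ᵥ z → x ≈ᵥ z
≈ᵥ-trans e f k = trans (e k) (f k)

sumℚ-cong : ∀ {k} {f g : Fin k → ℚ} → (∀ j → f j ≡ g j) → sumℚ f ≡ sumℚ g
sumℚ-cong {zero} e = refl
sumℚ-cong {suc k} e = cong₂ _+_ (e zero) (sumℚ-cong (e ∘ suc))

sumℚ-zero : ∀ {k} (f : Fin k → ℚ) → (∀ j → f j ≡ 0ℚ) → sumℚ f ≡ 0ℚ
sumℚ-zero {zero} f e = refl
sumℚ-zero {suc k} f e = cong₂ _+_ (e zero) (sumℚ-zero (f ∘ suc) (e ∘ suc))

sumℚ-distrib-+ : ∀ {k} (f g : Fin k → ℚ) → sumℚ (λ j → f j + g j) ≡ sumℚ f + sumℚ g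
sumℚ-distrib-+ {zero} f g = refl
sumℚ-distrib-+ {suc k} f g =
  trans (cong (f zero + g zero +_) (sumℚ-distrib-+ (f ∘ suc) (g ∘ suc)))
        (solve 4 (λ a b c d → (a :+ b) :+ (c :+ d) := (a :+ c) :+ (b :+ d)) refl
               (f zero) (g zero) (sumℚ (f ∘ suc)) (sumℚ (g ∘ suc)))

sumℚ-*ˡ : ∀ {k} (c : ℚ) (f : Fin k → ℚ) → sumℚ (λ j → c * f j) ≡ c * sumℚ f
sumℚ-*ˡ {zero} c f = sym (ℚP.*-zeroʳ c)
sumℚ-*ˡ {suc k} c f =
  trans (cong (c * f zero +_) (sumℚ-*ˡ c (f ∘ suc))) (sym (ℚP.*-distribˡ-+ c (f zero) _))

sumℚ-neg : ∀ {k} (f : Fin k → ℚ) → sumℚ (-_ ∘ f) ≡ - sumℚ f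
sumℚ-neg {k} f = trans (sumℚ-cong {k} (λ j → solve 1 (λ x → :- x := con (- 1ℚ) :* x) refl (f j)))
                       (trans (sumℚ-*ˡ (- 1ℚ) f) (solve 1 (λ x → con (- 1ℚ) :* x := :- x) refl (sumℚ f)))

sumℚ-++ : ∀ {m n} (f : Fin m → ℚ) (g : Fin n → ℚ) → sumℚ (f ++ g) ≡ sumℚ f + sumℚ g
sumℚ-++ {zero} f g = sym (ℚP.+-identityˡ _)
sumℚ-++ {suc m} {n} f g =
  trans (cong (f zero +_) (trans (sumℚ-cong tail-++) (sumℚ-++ (f ∘ suc) g)))
        (sym (ℚP.+-assoc (f zero) _ _))
  where
  tail-++ : ∀ j → (f ++ g) (suc j) ≡ ((f ∘ suc) ++ g) j
  tail-++ j with splitAt m j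
  ... | inj₁ _ = refl
  ... | inj₂ _ = refl

sumℚ-remove : ∀ {k} (f : Fin (suc k) → ℚ) (i : Fin (suc k)) →
              sumℚ f ≡ f i + sumℚ (f ∘ punchIn i)
sumℚ-remove f zero = refl
sumℚ-remove {suc k} f (suc i) =
  trans (cong (f zero +_) (sumℚ-remove (f ∘ suc) i))
        (solve 3 (λ a b c → a :+ (b :+ c) := b :+ (a :+ c)) refl (f zero) (f (suc i)) _)

sumℚ-single : ∀ {k} (f : Fin k → ℚ) (i : Fin k) → (∀ j → j ≢ i → f j ≡ 0ℚ) → sumℚ f ≡ f i
sumℚ-single {suc k} f i others-zero =
  trans (sumℚ-remove f i)
        (trans (cong (f i +_) (sumℚ-zero _ λ j → others-zero (punchIn i j) (FinP.punchInᵢ≢i i j)))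
               (ℚP.+-identityʳ (f i)))

sumℚ-nonNeg : ∀ {k} (f : Fin k → ℚ) → (∀ j → 0ℚ ≤ f j) → 0ℚ ≤ sumℚ f
sumℚ-nonNeg {zero} f f≥0 = ℚP.≤-refl
sumℚ-nonNeg {suc k} f f≥0 = ℚP.+-mono-≤ (f≥0 zero) (sumℚ-nonNeg (f ∘ suc) (f≥0 ∘ suc))

sumℚ≡0⇒zero : ∀ {k} (f : Fin k → ℚ) → (∀ j → 0ℚ ≤ f j) → sumℚ f ≡ 0ℚ → ∀ j → f j ≡ 0ℚ
sumℚ≡0⇒zero {suc k} f f≥0 sum≡0 = λ { zero → head≡0 ; (suc j) → sumℚ≡0⇒zero (f ∘ suc) (f≥0 ∘ suc) tail≡0 j }
  where
  head≤0 : f zero ≤ 0ℚ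
  head≤0 = subst₂ _≤_ (ℚP.+-identityʳ (f zero)) sum≡0
                  (ℚP.+-monoʳ-≤ (f zero) (sumℚ-nonNeg (f ∘ suc) (f≥0 ∘ suc)))
  head≡0 : f zero ≡ 0ℚ
  head≡0 = ℚP.≤-antisym head≤0 (f≥0 zero)
  tail≡0 : sumℚ (f ∘ suc) ≡ 0ℚ
  tail≡0 = trans (sym (ℚP.+-identityˡ _)) (trans (cong (_+ sumℚ (f ∘ suc)) (sym head≡0)) sum≡0)

sumᵥ-apply : ∀ {k d} (f : Fin k → Vecℚ d) (i : Fin d) → sumᵥ f i ≡ sumℚ (λ j → f j i)
sumᵥ-apply {zero} f i = refl
sumᵥ-apply {suc k} f i = cong (f zero i +_) (sumᵥ-apply (f ∘ suc) i)

sumᵥ-cong : ∀ {k d} {f g : Fin k → Vecℚ d} → (∀ j → f j ≈ᵥ g j) → sumᵥ f ≈ᵥ sumᵥ g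
sumᵥ-cong {zero} e i = refl
sumᵥ-cong {suc k} e i = cong₂ _+_ (e zero i) (sumᵥ-cong (e ∘ suc) i)

sumᵥ-zero : ∀ {k d} → sumᵥ {k} {d} (λ _ → 0ᵥ) ≈ᵥ 0ᵥ
sumᵥ-zero {k} i = trans (sumᵥ-apply {k} (λ _ → 0ᵥ) i) (sumℚ-zero {k} _ (λ _ → refl))

sumᵥ-distrib-+ : ∀ {k d} (f g : Fin k → Vecℚ d) → sumᵥ (λ j → f j +ᵥ g j) ≈ᵥ (sumᵥ f +ᵥ sumᵥ g)
sumᵥ-distrib-+ f g i = begin
  sumᵥ (λ j → f j +ᵥ g j) i            ≡⟨ sumᵥ-apply (λ j → f j +ᵥ g j) i ⟩
  sumℚ (λ j → f j i + g j i)           ≡⟨ sumℚ-distrib-+ (λ j → f j i) (λ j → g j i) ⟩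
  sumℚ (λ j → f j i) + sumℚ (λ j → g j i) ≡⟨ sym (cong₂ _+_ (sumᵥ-apply f i) (sumᵥ-apply g i)) ⟩
  sumᵥ f i + sumᵥ g i                  ∎
  where open ≡-Reasoning

sumᵥ-*ˡ : ∀ {k d} (c : ℚ) (f : Fin k → Vecℚ d) → sumᵥ (λ j → c ·ᵥ f j) ≈ᵥ (c ·ᵥ sumᵥ f)
sumᵥ-*ˡ {zero} c f i = sym (ℚP.*-zeroʳ c)
sumᵥ-*ˡ {suc k} c f i =
  trans (cong (c * f zero i +_) (sumᵥ-*ˡ c (f ∘ suc) i)) (sym (ℚP.*-distribˡ-+ c (f zero i) _))

sumᵥ-single : ∀ {k d} (f : Fin k → Vecℚ d) (i : Fin k) → (∀ j → j ≢ i → f j ≈ᵥ 0ᵥ) → sumᵥ f ≈ᵥ f i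
sumᵥ-single f i others-zero x =
  trans (sumᵥ-apply f x) (sumℚ-single (λ j → f j x) i (λ j j≢i → others-zero j j≢i x))

sumᵥ-++ : ∀ {m n d} (f : Fin m → Vecℚ d) (g : Fin n → Vecℚ d) → sumᵥ (f ++ g) ≈ᵥ (sumᵥ f +ᵥ sumᵥ g)
sumᵥ-++ {m} f g i =
  trans (sumᵥ-apply (f ++ g) i)
        (trans (sumℚ-cong apply-++) (trans (sumℚ-++ (λ j → f j i) (λ j → g j i))
               (sym (cong₂ _+_ (sumᵥ-apply f i) (sumᵥ-apply g i)))))
  where
  apply-++ : ∀ j → (f ++ g) j i ≡ ((λ j → f j i) ++ (λ j → g j i)) j
  apply-++ j with splitAt m j
  ... | inj₁ _ = refl
  ... | inj₂ _ = refl

-- `z / 1` normalises to this record, which exposes its numerator.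
fromℤ : ℤ → ℚ
fromℤ z = mkℚ z 0 (Coprime.sym (Coprime.1-coprimeTo ℤ.∣ z ∣))

/1≡fromℤ : ∀ z → z / 1 ≡ fromℤ z
/1≡fromℤ z = ℚP.↥p/↧p≡p (fromℤ z)

/1-homo-+ : ∀ a b → (a ℤ.+ b) / 1 ≡ a / 1 + b / 1
/1-homo-+ a b rewrite /1≡fromℤ (a ℤ.+ b) | /1≡fromℤ a | /1≡fromℤ b =
  ℚP.toℚᵘ-injective (ℚᵘP.≃-trans (ℚᵘ.*≡* numerators) (ℚᵘP.≃-sym (ℚP.toℚᵘ-homo-+ (fromℤ a) (fromℤ b))))
  where
  numerators : (a ℤ.+ b) ℤ.* ℤ.+ 1 ≡ (a ℤ.* ℤ.+ 1 ℤ.+ b ℤ.* ℤ.+ 1) ℤ.* ℤ.+ 1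
  numerators rewrite ℤP.*-identityʳ (a ℤ.+ b) | ℤP.*-identityʳ a | ℤP.*-identityʳ b
                   | ℤP.*-identityʳ (a ℤ.+ b) = refl

/1-homo-* : ∀ a b → (a ℤ.* b) / 1 ≡ (a / 1) * (b / 1)
/1-homo-* a b rewrite /1≡fromℤ (a ℤ.* b) | /1≡fromℤ a | /1≡fromℤ b =
  ℚP.toℚᵘ-injective (ℚᵘP.≃-trans (ℚᵘ.*≡* refl) (ℚᵘP.≃-sym (ℚP.toℚᵘ-homo-* (fromℤ a) (fromℤ b))))

/1-homo‿- : ∀ a → (ℤ.- a) / 1 ≡ - (a / 1)
/1-homo‿- a rewrite /1≡fromℤ (ℤ.- a) | /1≡fromℤ a =
  ℚP.toℚᵘ-injective (ℚᵘP.≃-trans (ℚᵘ.*≡* refl) (ℚᵘP.≃-sym (ℚP.toℚᵘ-homo‿- (fromℤ a))))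

/1-injective : ∀ a b → a / 1 ≡ b / 1 → a ≡ b
/1-injective a b e rewrite /1≡fromℤ a | /1≡fromℤ b = cong ℚ.numerator e

/1-mono-≤ : ∀ a b → a ℤ.≤ b → a / 1 ≤ b / 1
/1-mono-≤ a b a≤b rewrite /1≡fromℤ a | /1≡fromℤ b =
  ℚ.*≤* (subst₂ ℤ._≤_ (sym (ℤP.*-identityʳ a)) (sym (ℤP.*-identityʳ b)) a≤b)

/1-cancel-≤ : ∀ a b → a / 1 ≤ b / 1 → a ℤ.≤ b
/1-cancel-≤ a b a≤b rewrite /1≡fromℤ a | /1≡fromℤ b with a≤b
... | ℚ.*≤* a*1≤b*1 = subst₂ ℤ._≤_ (ℤP.*-identityʳ a) (ℤP.*-identityʳ b) a*1≤b*1

/1-cancel-< : ∀ a b → a / 1 < b / 1 → a ℤ.< b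
/1-cancel-< a b a<b rewrite /1≡fromℤ a | /1≡fromℤ b with a<b
... | ℚ.*<* a*1<b*1 = subst₂ ℤ._<_ (ℤP.*-identityʳ a) (ℤP.*-identityʳ b) a*1<b*1

nonNeg-/1⇒ℕ : ∀ z → 0ℚ ≤ z / 1 → ∃[ n ] z ≡ ℤ.+ n
nonNeg-/1⇒ℕ (ℤ.+ n) _ = n , refl
nonNeg-/1⇒ℕ ℤ.-[1+ n ] 0≤z with /1-cancel-≤ (ℤ.+ 0) ℤ.-[1+ n ] 0≤z
... | ()

ℕtoℚ-homo-+ : ∀ a b → ℕtoℚ (a ℕ.+ b) ≡ ℕtoℚ a + ℕtoℚ b
ℕtoℚ-homo-+ a b = trans (cong (_/ 1) (ℤP.pos-+ a b)) (/1-homo-+ (ℤ.+ a) (ℤ.+ b))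

ℕtoℚ-homo-* : ∀ a b → ℕtoℚ (a ℕ.* b) ≡ ℕtoℚ a * ℕtoℚ b
ℕtoℚ-homo-* a b = trans (cong (_/ 1) (ℤP.pos-* a b)) (/1-homo-* (ℤ.+ a) (ℤ.+ b))

ℕtoℚ-homo-∸ : ∀ a b → b ℕ.≤ a → ℕtoℚ (a ℕ.∸ b) ≡ ℕtoℚ a + - ℕtoℚ b
ℕtoℚ-homo-∸ a b b≤a =
  trans (solve 2 (λ x y → x := (x :+ y) :+ (:- y)) refl (ℕtoℚ (a ℕ.∸ b)) (ℕtoℚ b))
        (cong (_+ - ℕtoℚ b) (trans (sym (ℕtoℚ-homo-+ (a ℕ.∸ b) b)) (cong ℕtoℚ (ℕP.m∸n+n≡m b≤a))))

ℕtoℚ-mono-≤ : ∀ a b → a ℕ.≤ b → ℕtoℚ a ≤ ℕtoℚ b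
ℕtoℚ-mono-≤ a b a≤b = /1-mono-≤ (ℤ.+ a) (ℤ.+ b) (ℤ.+≤+ a≤b)

ℕtoℚ-cancel-≤ : ∀ a b → ℕtoℚ a ≤ ℕtoℚ b → a ℕ.≤ b
ℕtoℚ-cancel-≤ a b a≤b with /1-cancel-≤ (ℤ.+ a) (ℤ.+ b) a≤b
... | ℤ.+≤+ a≤b′ = a≤b′

ℕtoℚ-cancel-< : ∀ a b → ℕtoℚ a < ℕtoℚ b → a ℕ.< b
ℕtoℚ-cancel-< a b a<b with /1-cancel-< (ℤ.+ a) (ℤ.+ b) a<b
... | ℤ.+<+ a<b′ = a<b′

ℕtoℚ-injective : ∀ a b → ℕtoℚ a ≡ ℕtoℚ b → a ≡ b
ℕtoℚ-injective a b e =
  ℕP.≤-antisym (ℕtoℚ-cancel-≤ a b (ℚP.≤-reflexive e)) (ℕtoℚ-cancel-≤ b a (ℚP.≤-reflexive (sym e)))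

ℕtoℚ-nonNeg : ∀ a → 0ℚ ≤ ℕtoℚ a
ℕtoℚ-nonNeg a = ℕtoℚ-mono-≤ 0 a ℕ.z≤n

ℕtoℚ-pos : ∀ a → 1 ℕ.≤ a → 0ℚ < ℕtoℚ a
ℕtoℚ-pos a 1≤a = ℚP.<-≤-trans (ℚP.positive⁻¹ 1ℚ) (ℕtoℚ-mono-≤ 1 a 1≤a)

sumℚ-ℕtoℚ : ∀ {k} (g : Fin k → ℕ) → sumℚ (ℕtoℚ ∘ g) ≡ ℕtoℚ (sumℕ g)
sumℚ-ℕtoℚ {zero} g = refl
sumℚ-ℕtoℚ {suc k} g =
  trans (cong (ℕtoℚ (g zero) +_) (sumℚ-ℕtoℚ (g ∘ suc))) (sym (ℕtoℚ-homo-+ (g zero) _))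

toℚ-sumᶻ : ∀ {k d} (f : Fin k → Vecℤ d) → toℚ (sumᶻ f) ≈ᵥ sumᵥ (toℚ ∘ f)
toℚ-sumᶻ {zero} f i = refl
toℚ-sumᶻ {suc k} f i =
  trans (/1-homo-+ (f zero i) (sumᶻ (f ∘ suc) i)) (cong (toℚ (f zero) i +_) (toℚ-sumᶻ (f ∘ suc) i))

sumᶻ-cong : ∀ {k d} {f g : Fin k → Vecℤ d} → (∀ j → f j ≈ᶻ g j) → sumᶻ f ≈ᶻ sumᶻ g
sumᶻ-cong {zero} e i = refl
sumᶻ-cong {suc k} e i = cong₂ ℤ._+_ (e zero i) (sumᶻ-cong (e ∘ suc) i)

toℚ-+ᶻ : ∀ {d} (a b : Vecℤ d) → toℚ (a +ᶻ b) ≈ᵥ (toℚ a +ᵥ toℚ b)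
toℚ-+ᶻ a b k = /1-homo-+ (a k) (b k)

_-ᶻ_ : ∀ {d} → Vecℤ d → Vecℤ d → Vecℤ d
(a -ᶻ b) k = a k ℤ.- b k

+ᶻ-[-ᶻ] : ∀ {d} (z a : Vecℤ d) → z ≈ᶻ (a +ᶻ (z -ᶻ a))
+ᶻ-[-ᶻ] z a k = ℤSolver.solve 2 (λ z a → z ℤSolver.:= a ℤSolver.:+ (z ℤSolver.:- a)) refl (z k) (a k)

[-ᶻ]-+ᶻ : ∀ {d} (z a : Vecℤ d) → z ≈ᶻ ((z -ᶻ a) +ᶻ a)
[-ᶻ]-+ᶻ z a k = ℤSolver.solve 2 (λ z a → z ℤSolver.:= (z ℤSolver.:- a) ℤSolver.:+ a) refl (z k) (a k)

toℚ-[-ᶻ] : ∀ {d} (z a : Vecℤ d) {y} → toℚ z ≈ᵥ (y +ᵥ toℚ a) → toℚ (z -ᶻ a) ≈ᵥ y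
toℚ-[-ᶻ] z a {y} z≈y+a k =
  trans (/1-homo-+ (z k) (ℤ.- a k))
        (trans (cong₂ _+_ (z≈y+a k) (/1-homo‿- (a k)))
               (solve 2 (λ y a → y :+ a :+ (:- a) := y) refl (y k) (toℚ a k)))

toℚ-injective : ∀ {d} (x y : Vecℤ d) → toℚ x ≈ᵥ toℚ y → x ≈ᶻ y
toℚ-injective x y e k = /1-injective (x k) (y k) (e k)

*-nonNeg : ∀ {a b : ℚ} → 0ℚ ≤ a → 0ℚ ≤ b → 0ℚ ≤ a * b
*-nonNeg {a} {b} 0≤a 0≤b =
  ℚP.nonNegative⁻¹ _ {{ℚP.nonNeg*nonNeg⇒nonNeg a {{ℚ.nonNegative 0≤a}} b {{ℚ.nonNegative 0≤b}}}}

p≤q⇒0≤q-p : ∀ {p q} → p ≤ q → 0ℚ ≤ q + - p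
p≤q⇒0≤q-p {p} {q} p≤q = subst (_≤ q + - p) (ℚP.+-inverseʳ p) (ℚP.+-monoˡ-≤ (- p) p≤q)

0≤q-p⇒p≤q : ∀ {p q} → 0ℚ ≤ q + - p → p ≤ q
0≤q-p⇒p≤q {p} {q} 0≤q-p =
  subst₂ _≤_ (ℚP.+-identityˡ p) (solve 2 (λ p q → q :+ (:- p) :+ p := q) refl p q) (ℚP.+-monoˡ-≤ p 0≤q-p)

0≤1 : 0ℚ ≤ 1ℚ
0≤1 = ℚP.nonNegative⁻¹ 1ℚ

-- A total inverse, with the junk value inv 0ℚ ≡ 0ℚ; it spares instance arguments.
inv : ℚ → ℚ
inv q with q ℚP.≟ 0ℚ
... | yes _ = 0ℚ
... | no q≢0 = ℚ.1/_ q {{ℚ.≢-nonZero q≢0}}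

*-inv : ∀ q → q ≢ 0ℚ → q * inv q ≡ 1ℚ
*-inv q q≢0 with q ℚP.≟ 0ℚ
... | yes q≡0 = ⊥-elim (q≢0 q≡0)
... | no q≢0′ = ℚP.*-inverseʳ q {{ℚ.≢-nonZero q≢0′}}

inv-pos : ∀ q → 0ℚ < q → 0ℚ < inv q
inv-pos q 0<q with q ℚP.≟ 0ℚ
... | yes q≡0 = ⊥-elim (ℚP.<-irrefl (sym q≡0) 0<q)
... | no _ = ℚP.positive⁻¹ _ {{ℚP.1/pos⇒pos q {{ℚ.positive 0<q}}}}

>0⇒≢0 : ∀ {q} → 0ℚ < q → q ≢ 0ℚ
>0⇒≢0 0<q q≡0 = ℚP.<-irrefl (sym q≡0) 0<q

inv-cancelˡ : ∀ q → q ≢ 0ℚ → ∀ x → q * (inv q * x) ≡ x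
inv-cancelˡ q q≢0 x = trans (sym (ℚP.*-assoc q (inv q) x)) (trans (cong (_* x) (*-inv q q≢0)) (ℚP.*-identityˡ x))

inv-cancelʳ : ∀ q → q ≢ 0ℚ → ∀ x → inv q * (q * x) ≡ x
inv-cancelʳ q q≢0 x =
  trans (sym (ℚP.*-assoc (inv q) q x)) (trans (cong (_* x) (trans (ℚP.*-comm (inv q) q) (*-inv q q≢0))) (ℚP.*-identityˡ x))

-- Cones

-- `Conv S` is `Cone S 1ℚ` with the fields put in a Σ-type.
record Cone {d} (S : Subset d) (t : ℚ) (x : Vecℚ d) : Set where
  constructor cone
  field
    {size} : ℕ
    points : Fin size → Vecℚ d
    weights : Fin size → ℚ
    points∈S : ∀ j → S (points j)
    weights≥0 : ∀ j → 0ℚ ≤ weights j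
    weights-sum : sumℚ weights ≡ t
    combination : x ≈ᵥ sumᵥ (λ j → weights j ·ᵥ points j)

Conv⇒Cone : ∀ {d} {S : Subset d} {x} → Conv S x → Cone S 1ℚ x
Conv⇒Cone (_ , p , l , p∈S , l≥0 , Σl , x≈) = cone p l p∈S l≥0 Σl x≈

Cone⇒Conv : ∀ {d} {S : Subset d} {x} → Cone S 1ℚ x → Conv S x
Cone⇒Conv (cone p l p∈S l≥0 Σl x≈) = _ , p , l , p∈S , l≥0 , Σl , x≈

module _ {d : ℕ} {S : Subset d} where

  Cone-resp-≈ : ∀ {t x y} → x ≈ᵥ y → Cone S t x → Cone S t y
  Cone-resp-≈ x≈y (cone p l p∈S l≥0 Σl x≈) = cone p l p∈S l≥0 Σl (≈ᵥ-trans (≈ᵥ-sym x≈y) x≈)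

  Cone-resp-weight : ∀ {s t x} → s ≡ t → Cone S s x → Cone S t x
  Cone-resp-weight s≡t (cone p l p∈S l≥0 Σl x≈) = cone p l p∈S l≥0 (trans Σl s≡t) x≈

  Cone-zero : Cone S 0ℚ 0ᵥ
  Cone-zero = cone {size = 0} (λ ()) (λ ()) (λ ()) (λ ()) refl (λ _ → refl)

  Cone-gen : ∀ {x} → S x → Cone S 1ℚ x
  Cone-gen {x} x∈S = cone {size = 1} (λ _ → x) (λ _ → 1ℚ) (λ _ → x∈S) (λ _ → 0≤1) refl
    λ k → sym (trans (ℚP.+-identityʳ _) (ℚP.*-identityˡ _))

  Cone-+ : ∀ {s t x y} → Cone S s x → Cone S t y → Cone S (s + t) (x +ᵥ y)
  Cone-+ {x = x} {y} (cone {k} p l p∈S l≥0 Σl x≈) (cone {k′} p′ l′ p′∈S l′≥0 Σl′ y≈) =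
    cone (p ++ p′) (l ++ l′) (all-++ S p p′ p∈S p′∈S) (all-++ (0ℚ ≤_) l l′ l≥0 l′≥0)
      (trans (sumℚ-++ l l′) (cong₂ _+_ Σl Σl′)) x+y≈
    where
    all-++ : ∀ {A : Set} (P : A → Set) (f : Fin k → A) (g : Fin k′ → A) →
             (∀ j → P (f j)) → (∀ j → P (g j)) → ∀ j → P ((f ++ g) j)
    all-++ P f g Pf Pg j with splitAt k j
    ... | inj₁ i = Pf i
    ... | inj₂ i = Pg i
    scale-++ : ∀ j → ((l ++ l′) j ·ᵥ (p ++ p′) j) ≈ᵥ ((λ i → l i ·ᵥ p i) ++ (λ i → l′ i ·ᵥ p′ i)) j
    scale-++ j _ with splitAt k j
    ... | inj₁ _ = refl
    ... | inj₂ _ = refl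
    x+y≈ : (x +ᵥ y) ≈ᵥ sumᵥ (λ j → (l ++ l′) j ·ᵥ (p ++ p′) j)
    x+y≈ i = trans (cong₂ _+_ (x≈ i) (y≈ i))
                   (sym (trans (sumᵥ-cong scale-++ i) (sumᵥ-++ (λ j → l j ·ᵥ p j) (λ j → l′ j ·ᵥ p′ j) i)))

  Cone-scale : ∀ {t x} (a : ℚ) → 0ℚ ≤ a → Cone S t x → Cone S (a * t) (a ·ᵥ x)
  Cone-scale a 0≤a (cone p l p∈S l≥0 Σl x≈) =
    cone p (λ j → a * l j) p∈S (λ j → *-nonNeg 0≤a (l≥0 j))
      (trans (sumℚ-*ˡ a l) (cong (a *_) Σl))
      λ i → trans (cong (a *_) (x≈ i))
                  (sym (trans (sumᵥ-cong (λ j i′ → ℚP.*-assoc a (l j) (p j i′)) i)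
                              (sumᵥ-*ˡ a (λ j → l j ·ᵥ p j) i)))

  Cone-sum : ∀ {m} (t : Fin m → ℚ) (x : Fin m → Vecℚ d) → (∀ i → Cone S (t i) (x i)) →
             Cone S (sumℚ t) (sumᵥ x)
  Cone-sum {zero} t x c = Cone-zero
  Cone-sum {suc m} t x c = Cone-+ (c zero) (Cone-sum (t ∘ suc) (x ∘ suc) (c ∘ suc))

  Cone-weight-0 : ∀ {x} → Cone S 0ℚ x → x ≈ᵥ 0ᵥ
  Cone-weight-0 (cone p l _ l≥0 Σl x≈) i =
    trans (x≈ i) (trans (sumᵥ-apply (λ j → l j ·ᵥ p j) i)
          (sumℚ-zero _ λ j → trans (cong (_* p j i) (sumℚ≡0⇒zero l l≥0 Σl j)) (ℚP.*-zeroˡ (p j i))))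

  Cone-unscale : ∀ (C : ℚ) → 0ℚ < C → ∀ {t x} → Cone S (C * t) x →
                 Σ (Vecℚ d) λ u → Cone S t u × (x ≈ᵥ (C ·ᵥ u))
  Cone-unscale C 0<C {t} {x} c =
    inv C ·ᵥ x ,
    Cone-resp-weight (inv-cancelʳ C (>0⇒≢0 0<C) t) (Cone-scale (inv C) (ℚP.<⇒≤ (inv-pos C 0<C)) c) ,
    λ i → sym (inv-cancelˡ C (>0⇒≢0 0<C) (x i))

  ⊙Conv⇒Cone : ∀ n {y} → (n ⊙ Conv S) y → Cone S (ℕtoℚ n) y
  ⊙Conv⇒Cone n (u , u∈S , y≈) =
    Cone-resp-≈ (≈ᵥ-sym y≈) (Cone-resp-weight (ℚP.*-identityʳ (ℕtoℚ n))
                                               (Cone-scale (ℕtoℚ n) (ℕtoℚ-nonNeg n) (Conv⇒Cone u∈S)))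

  Cone⇒⊙Conv : ∀ n → 1 ℕ.≤ n → ∀ {y} → Cone S (ℕtoℚ n) y → (n ⊙ Conv S) y
  Cone⇒⊙Conv n 1≤n c =
    map₂ (map₁ Cone⇒Conv) (Cone-unscale (ℕtoℚ n) (ℕtoℚ-pos n 1≤n) (Cone-resp-weight (sym (ℚP.*-identityʳ (ℕtoℚ n))) c))

⊙Conv-+ : ∀ {d} (S : Subset d) c {x y} → (suc c ⊙ Conv S) x → Conv S y → (suc (suc c) ⊙ Conv S) (x +ᵥ y)
⊙Conv-+ S c x∈ y∈ =
  Cone⇒⊙Conv (suc (suc c)) (ℕ.s≤s ℕ.z≤n)
    (Cone-resp-weight (trans (sym (ℕtoℚ-homo-+ (suc c) 1)) (cong ℕtoℚ (ℕP.+-comm (suc c) 1)))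
                      (Cone-+ (⊙Conv⇒Cone (suc c) x∈) (Conv⇒Cone {S = S} y∈)))

-- Homogeneous linear systems

dot : ∀ {k} → (Fin k → ℚ) → (Fin k → ℚ) → ℚ
dot u v = sumℚ (λ j → u j * v j)

Kernel : ∀ {r k} → (Fin r → Fin k → ℚ) → (Fin k → ℚ) → Set
Kernel A μ = ∀ i → dot (A i) μ ≡ 0ℚ

NonTrivial : ∀ {k} → (Fin k → ℚ) → Set
NonTrivial μ = ∃ λ j → μ j ≢ 0ℚ

dot-remove : ∀ {k} (u v : Fin (suc k) → ℚ) j₀ → dot u v ≡ u j₀ * v j₀ + dot (u ∘ punchIn j₀) (v ∘ punchIn j₀)
dot-remove u v j₀ = sumℚ-remove (λ j → u j * v j) j₀

dot-+-* : ∀ {k} (u w v : Fin k → ℚ) c → dot (λ j → u j + c * w j) v ≡ dot u v + c * dot w v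
dot-+-* {k} u w v c =
  trans (sumℚ-cong {k} (λ j → solve 4 (λ a b c x → (a :+ c :* b) :* x := a :* x :+ c :* (b :* x))
                                        refl (u j) (w j) c (v j)))
        (trans (sumℚ-distrib-+ (λ j → u j * v j) (λ j → c * (w j * v j)))
               (cong (dot u v +_) (sumℚ-*ˡ c (λ j → w j * v j))))

-- One step of Gaussian elimination with pivot A zero j₀.
eliminate : ∀ {r k} (A : Fin (suc r) → Fin (suc k) → ℚ) → Fin (suc k) → Fin r → Fin k → ℚ
eliminate A j₀ i j = A (suc i) (punchIn j₀ j) + - (A (suc i) j₀ * inv (A zero j₀)) * A zero (punchIn j₀ j)

eliminate-dot : ∀ {r k} (A : Fin (suc r) → Fin (suc k) → ℚ) j₀ → A zero j₀ ≢ 0ℚ → ∀ μ i →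
  dot (eliminate A j₀ i) (μ ∘ punchIn j₀) ≡ dot (A (suc i)) μ + - (A (suc i) j₀ * inv (A zero j₀)) * dot (A zero) μ
eliminate-dot {r} {k} A j₀ a≢0 μ i = begin
  dot (eliminate A j₀ i) ν
    ≡⟨ dot-+-* (A (suc i) ∘ punchIn j₀) (A zero ∘ punchIn j₀) ν (- (c * ia)) ⟩
  Rᵢ + - (c * ia) * R₀
    ≡⟨ sym (ℚP.+-identityʳ _) ⟩
  Rᵢ + - (c * ia) * R₀ + 0ℚ
    ≡⟨ cong (Rᵢ + - (c * ia) * R₀ +_) (sym pivot-term) ⟩
  Rᵢ + - (c * ia) * R₀ + c * x * (1ℚ + - (a * ia))
    ≡⟨ solve 6 (λ r r₀ c ia a x → r :+ (:- (c :* ia)) :* r₀ :+ c :* x :* (con 1ℚ :+ (:- (a :* ia)))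
                                  := (c :* x :+ r) :+ (:- (c :* ia)) :* (a :* x :+ r₀))
               refl Rᵢ R₀ c ia a x ⟩
  (c * x + Rᵢ) + - (c * ia) * (a * x + R₀)
    ≡⟨ sym (cong₂ (λ y z → y + - (c * ia) * z) (dot-remove (A (suc i)) μ j₀) (dot-remove (A zero) μ j₀)) ⟩
  dot (A (suc i)) μ + - (c * ia) * dot (A zero) μ ∎
  where
  open ≡-Reasoning
  ν = μ ∘ punchIn j₀
  x = μ j₀
  a = A zero j₀
  ia = inv a
  c = A (suc i) j₀
  Rᵢ = dot (A (suc i) ∘ punchIn j₀) ν
  R₀ = dot (A zero ∘ punchIn j₀) ν
  pivot-term : c * x * (1ℚ + - (a * ia)) ≡ 0ℚ
  pivot-term = trans (cong (λ e → c * x * (1ℚ + - e)) (*-inv a a≢0)) (ℚP.*-zeroʳ (c * x))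

dot-congʳ : ∀ {k} (u : Fin k → ℚ) {v w : Fin k → ℚ} → (∀ j → v j ≡ w j) → dot u v ≡ dot u w
dot-congʳ u v≗w = sumℚ-cong (λ j → cong (u j *_) (v≗w j))

module _ {r k : ℕ} (A : Fin (suc r) → Fin (suc k) → ℚ) (j₀ : Fin (suc k)) (a≢0 : A zero j₀ ≢ 0ℚ) where

  private
    a = A zero j₀

  Kernel-eliminate : ∀ μ → Kernel A μ → Kernel (eliminate A j₀) (μ ∘ punchIn j₀)
  Kernel-eliminate μ Aμ≡0 i = begin
    dot (eliminate A j₀ i) (μ ∘ punchIn j₀)
      ≡⟨ eliminate-dot A j₀ a≢0 μ i ⟩
    dot (A (suc i)) μ + - (A (suc i) j₀ * inv a) * dot (A zero) μ
      ≡⟨ cong₂ (λ y z → y + - (A (suc i) j₀ * inv a) * z) (Aμ≡0 (suc i)) (Aμ≡0 zero) ⟩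
    0ℚ + - (A (suc i) j₀ * inv a) * 0ℚ
      ≡⟨ solve 1 (λ c → con 0ℚ :+ c :* con 0ℚ := con 0ℚ) refl (- (A (suc i) j₀ * inv a)) ⟩
    0ℚ ∎
    where open ≡-Reasoning

  Kernel-pivot : ∀ μ → Kernel A μ → (∀ j → μ (punchIn j₀ j) ≡ 0ℚ) → μ j₀ ≡ 0ℚ
  Kernel-pivot μ Aμ≡0 rest≡0 = begin
    μ j₀                ≡⟨ sym (inv-cancelʳ a a≢0 (μ j₀)) ⟩
    inv a * (a * μ j₀)  ≡⟨ cong (inv a *_) pivot-term ⟩
    inv a * 0ℚ          ≡⟨ ℚP.*-zeroʳ (inv a) ⟩
    0ℚ                  ∎
    where
    open ≡-Reasoning
    pivot-term : a * μ j₀ ≡ 0ℚ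
    pivot-term = begin
      a * μ j₀
        ≡⟨ sym (ℚP.+-identityʳ _) ⟩
      a * μ j₀ + 0ℚ
        ≡⟨ cong (a * μ j₀ +_) (sym (sumℚ-zero _ λ j → trans (cong (A zero (punchIn j₀ j) *_) (rest≡0 j))
                                                          (ℚP.*-zeroʳ (A zero (punchIn j₀ j))))) ⟩
      a * μ j₀ + dot (A zero ∘ punchIn j₀) (μ ∘ punchIn j₀)
        ≡⟨ sym (dot-remove (A zero) μ j₀) ⟩
      dot (A zero) μ
        ≡⟨ Aμ≡0 zero ⟩
      0ℚ ∎

  -- The pivot coordinate is chosen so that the pivot row vanishes.
  back-substitute : (Fin k → ℚ) → Fin (suc k) → ℚ
  back-substitute ν = insertAt ν j₀ (- (inv a * dot (A zero ∘ punchIn j₀) ν))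

  Kernel-back-substitute : ∀ ν → Kernel (eliminate A j₀) ν → Kernel A (back-substitute ν)
  Kernel-back-substitute ν Eν≡0 = row
    where
    open ≡-Reasoning
    S = dot (A zero ∘ punchIn j₀) ν
    μ = back-substitute ν
    μ-punchIn : ∀ j → μ (punchIn j₀ j) ≡ ν j
    μ-punchIn = insertAt-punchIn ν j₀ _
    row₀ : dot (A zero) μ ≡ 0ℚ
    row₀ = begin
      dot (A zero) μ
        ≡⟨ dot-remove (A zero) μ j₀ ⟩
      a * μ j₀ + dot (A zero ∘ punchIn j₀) (μ ∘ punchIn j₀)
        ≡⟨ cong₂ (λ x y → a * x + y) (insertAt-lookup ν j₀ _) (dot-congʳ (A zero ∘ punchIn j₀) μ-punchIn) ⟩
      a * - (inv a * S) + S
        ≡⟨ cong (_+ S) (sym (ℚP.neg-distribʳ-* a (inv a * S))) ⟩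
      - (a * (inv a * S)) + S
        ≡⟨ cong (λ y → - y + S) (inv-cancelˡ a a≢0 S) ⟩
      - S + S
        ≡⟨ ℚP.+-inverseˡ S ⟩
      0ℚ ∎
    row : Kernel A μ
    row zero = row₀
    row (suc i) = begin
      dot (A (suc i)) μ
        ≡⟨ solve 2 (λ y z → y := y :+ z :* con 0ℚ) refl (dot (A (suc i)) μ) (- (A (suc i) j₀ * inv a)) ⟩
      dot (A (suc i)) μ + - (A (suc i) j₀ * inv a) * 0ℚ
        ≡⟨ cong (λ z → dot (A (suc i)) μ + - (A (suc i) j₀ * inv a) * z) (sym row₀) ⟩
      dot (A (suc i)) μ + - (A (suc i) j₀ * inv a) * dot (A zero) μ
        ≡⟨ sym (eliminate-dot A j₀ a≢0 μ i) ⟩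
      dot (eliminate A j₀ i) (μ ∘ punchIn j₀)
        ≡⟨ dot-congʳ (eliminate A j₀ i) μ-punchIn ⟩
      dot (eliminate A j₀ i) ν
        ≡⟨ Eν≡0 i ⟩
      0ℚ ∎

Kernel-zero-row : ∀ {r k} (A : Fin (suc r) → Fin k → ℚ) → (∀ j → A zero j ≡ 0ℚ) →
                  ∀ μ → Kernel (A ∘ suc) μ → Kernel A μ
Kernel-zero-row {k = k} A row₀≡0 μ Aμ≡0 zero = sumℚ-zero {k} _ λ j → trans (cong (_* μ j) (row₀≡0 j)) (ℚP.*-zeroˡ (μ j))
Kernel-zero-row A row₀≡0 μ Aμ≡0 (suc i) = Aμ≡0 i

kernel-dichotomy : ∀ r k (A : Fin r → Fin k → ℚ) →
  (∃ λ μ → Kernel A μ × NonTrivial μ) ⊎ (∀ μ → Kernel A μ → ∀ j → μ j ≡ 0ℚ)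
kernel-dichotomy r zero A = inj₂ (λ _ _ ())
kernel-dichotomy zero (suc k) A = inj₁ ((λ _ → 1ℚ) , (λ ()) , zero , λ ())
kernel-dichotomy (suc r) (suc k) A with all? (λ j → A zero j ℚP.≟ 0ℚ)
... | yes row₀≡0 with kernel-dichotomy r (suc k) (A ∘ suc)
...   | inj₁ (μ , Aμ≡0 , μ≢0) = inj₁ (μ , Kernel-zero-row A row₀≡0 μ Aμ≡0 , μ≢0)
...   | inj₂ trivial = inj₂ (λ μ Aμ≡0 → trivial μ (Aμ≡0 ∘ suc))
kernel-dichotomy (suc r) (suc k) A | no row₀≢0 with ¬∀⟶∃¬ _ _ (λ j → A zero j ℚP.≟ 0ℚ) row₀≢0
... | j₀ , a≢0 with kernel-dichotomy r k (eliminate A j₀)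
...   | inj₁ (ν , Eν≡0 , j , νj≢0) =
  inj₁ (back-substitute A j₀ a≢0 ν , Kernel-back-substitute A j₀ a≢0 ν Eν≡0 ,
        punchIn j₀ j , λ μj≡0 → νj≢0 (trans (sym (insertAt-punchIn ν j₀ _ j)) μj≡0))
...   | inj₂ trivial = inj₂ all-zero
  where
  all-zero : ∀ μ → Kernel A μ → ∀ j → μ j ≡ 0ℚ
  all-zero μ Aμ≡0 j with j₀ ≟ j
  ... | yes refl = Kernel-pivot A j₀ a≢0 μ Aμ≡0 rest≡0
    where rest≡0 = trivial (μ ∘ punchIn j₀) (Kernel-eliminate A j₀ a≢0 μ Aμ≡0)
  ... | no j₀≢j = trans (cong μ (sym (FinP.punchIn-punchOut j₀≢j)))
                        (trivial (μ ∘ punchIn j₀) (Kernel-eliminate A j₀ a≢0 μ Aμ≡0) (punchOut j₀≢j))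

-- Carathéodory's theorem

AffineDependence : ∀ {k d} → (Fin k → Vecℚ d) → (Fin k → ℚ) → Set
AffineDependence p μ = (sumℚ μ ≡ 0ℚ) × (sumᵥ (λ j → μ j ·ᵥ p j) ≈ᵥ 0ᵥ)

-- Its kernel vectors are the affine dependences of p.
affineMatrix : ∀ {k d} → (Fin k → Vecℚ d) → Fin (suc d) → Fin k → ℚ
affineMatrix p zero j = 1ℚ
affineMatrix p (suc i) j = p j i

Kernel⇒AffineDependence : ∀ {k d} (p : Fin k → Vecℚ d) μ → Kernel (affineMatrix p) μ → AffineDependence p μ
Kernel⇒AffineDependence {k} p μ Mμ≡0 =
  trans (sumℚ-cong {k} (λ j → sym (ℚP.*-identityˡ (μ j)))) (Mμ≡0 zero) ,
  λ i → trans (sumᵥ-apply (λ j → μ j ·ᵥ p j) i) (trans (sumℚ-cong {k} (λ j → ℚP.*-comm (μ j) (p j i))) (Mμ≡0 (suc i)))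

AffineDependence⇒Kernel : ∀ {k d} (p : Fin k → Vecℚ d) μ → AffineDependence p μ → Kernel (affineMatrix p) μ
AffineDependence⇒Kernel {k} p μ (Σμ≡0 , Σμp≈0) zero = trans (sumℚ-cong {k} (λ j → ℚP.*-identityˡ (μ j))) Σμ≡0
AffineDependence⇒Kernel {k} p μ (Σμ≡0 , Σμp≈0) (suc i) =
  trans (sumℚ-cong {k} (λ j → ℚP.*-comm (p j i) (μ j))) (trans (sym (sumᵥ-apply (λ j → μ j ·ᵥ p j) i)) (Σμp≈0 i))

AffineDependence-neg : ∀ {k d} (p : Fin k → Vecℚ d) μ → AffineDependence p μ → AffineDependence p (-_ ∘ μ)
AffineDependence-neg {k} p μ (Σμ≡0 , Σμp≈0) = Σ-μ≡0 , Σ-μp≈0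
  where
  Σ-μ≡0 : sumℚ (-_ ∘ μ) ≡ 0ℚ
  Σ-μ≡0 = trans (sumℚ-neg μ) (cong -_ Σμ≡0)
  Σ-μp≈0 : sumᵥ (λ j → (- μ j) ·ᵥ p j) ≈ᵥ 0ᵥ
  Σ-μp≈0 i = trans (sumᵥ-cong {k} (λ j i′ → solve 2 (λ m x → (:- m) :* x := con (- 1ℚ) :* (m :* x)) refl (μ j) (p j i′)) i)
                   (trans (sumᵥ-*ˡ (- 1ℚ) (λ j → μ j ·ᵥ p j) i) (trans (cong (- 1ℚ *_) (Σμp≈0 i)) (ℚP.*-zeroʳ (- 1ℚ))))

affinelyIndependent⊎dependent : ∀ {k d} (p : Fin k → Vecℚ d) →
  AffinelyIndependent p ⊎ (∃ λ μ → AffineDependence p μ × ∃ λ j → 0ℚ < μ j)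
affinelyIndependent⊎dependent {k} {d} p with kernel-dichotomy (suc d) k (affineMatrix p)
... | inj₂ trivial = inj₁ λ μ Σμ≡0 Σμp≈0 → trivial μ (AffineDependence⇒Kernel p μ (Σμ≡0 , Σμp≈0))
... | inj₁ (μ , Mμ≡0 , j , μj≢0) with ℚP.<-cmp (μ j) 0ℚ
...   | tri< μj<0 _ _ = inj₂ (-_ ∘ μ , AffineDependence-neg p μ (Kernel⇒AffineDependence p μ Mμ≡0) , j , ℚP.neg-antimono-< μj<0)
...   | tri≈ _ μj≡0 _ = ⊥-elim (μj≢0 μj≡0)
...   | tri> _ _ μj>0 = inj₂ (μ , Kernel⇒AffineDependence p μ Mμ≡0 , j , μj>0)

Minimiser : ∀ {k} (μ key : Fin k → ℚ) → Set
Minimiser {k} μ key = Σ (Fin k) λ j* → 0ℚ < μ j* × (∀ j → 0ℚ < μ j → key j* ≤ key j)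

minimiser : ∀ {k} (μ key : Fin k → ℚ) → (∀ j → ¬ 0ℚ < μ j) ⊎ Minimiser μ key
minimiser {zero} μ key = inj₁ (λ ())
minimiser {suc k} μ key with minimiser (μ ∘ suc) (key ∘ suc) | 0ℚ ℚP.<? μ zero
... | inj₁ none | no μ₀≯0 = inj₁ λ { zero → μ₀≯0 ; (suc j) → none j }
... | inj₁ none | yes μ₀>0 = inj₂ (zero , μ₀>0 , λ { zero _ → ℚP.≤-refl ; (suc j) μj>0 → ⊥-elim (none j μj>0) })
... | inj₂ (j* , μj*>0 , min) | no μ₀≯0 = inj₂ (suc j* , μj*>0 , λ { zero μ₀>0 → ⊥-elim (μ₀≯0 μ₀>0) ; (suc j) → min j })
... | inj₂ (j* , μj*>0 , min) | yes μ₀>0 with key zero ℚP.≤? key (suc j*)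
...   | yes k₀≤ = inj₂ (zero , μ₀>0 , λ { zero _ → ℚP.≤-refl ; (suc j) μj>0 → ℚP.≤-trans k₀≤ (min j μj>0) })
...   | no k₀≰ = inj₂ (suc j* , μj*>0 , λ { zero _ → ℚP.<⇒≤ (ℚP.≰⇒> k₀≰) ; (suc j) → min j })

module _ {k d : ℕ} (p : Fin k → Vecℚ d) (μ : Fin k → ℚ) (dep : AffineDependence p μ) (l : Fin k → ℚ) (t : ℚ) where

  shift-sum : sumℚ (λ j → l j + - t * μ j) ≡ sumℚ l
  shift-sum = trans (sumℚ-distrib-+ l (λ j → - t * μ j))
                    (trans (cong (sumℚ l +_) (trans (sumℚ-*ˡ (- t) μ) (trans (cong (- t *_) (proj₁ dep)) (ℚP.*-zeroʳ (- t)))))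
                           (ℚP.+-identityʳ _))

  shift-combination : sumᵥ (λ j → (l j + - t * μ j) ·ᵥ p j) ≈ᵥ sumᵥ (λ j → l j ·ᵥ p j)
  shift-combination i = begin
    sumᵥ (λ j → (l j + - t * μ j) ·ᵥ p j) i
      ≡⟨ sumᵥ-cong (λ j i′ → solve 4 (λ a t m x → (a :+ t :* m) :* x := a :* x :+ t :* (m :* x)) refl (l j) (- t) (μ j) (p j i′)) i ⟩
    sumᵥ (λ j → (l j ·ᵥ p j) +ᵥ ((- t) ·ᵥ (μ j ·ᵥ p j))) i
      ≡⟨ sumᵥ-distrib-+ (λ j → l j ·ᵥ p j) (λ j → (- t) ·ᵥ (μ j ·ᵥ p j)) i ⟩
    sumᵥ (λ j → l j ·ᵥ p j) i + sumᵥ (λ j → (- t) ·ᵥ (μ j ·ᵥ p j)) i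
      ≡⟨ cong (sumᵥ (λ j → l j ·ᵥ p j) i +_) (sumᵥ-*ˡ (- t) (λ j → μ j ·ᵥ p j) i) ⟩
    sumᵥ (λ j → l j ·ᵥ p j) i + - t * sumᵥ (λ j → μ j ·ᵥ p j) i
      ≡⟨ cong (λ z → sumᵥ (λ j → l j ·ᵥ p j) i + - t * z) (proj₂ dep i) ⟩
    sumᵥ (λ j → l j ·ᵥ p j) i + - t * 0ℚ
      ≡⟨ trans (cong (sumᵥ (λ j → l j ·ᵥ p j) i +_) (ℚP.*-zeroʳ (- t))) (ℚP.+-identityʳ _) ⟩
    sumᵥ (λ j → l j ·ᵥ p j) i ∎
    where open ≡-Reasoning

drop-zero-weight : ∀ {k d} (p : Fin (suc k) → Vecℚ d) (l : Fin (suc k) → ℚ) j* → l j* ≡ 0ℚ →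
  sumℚ (l ∘ punchIn j*) ≡ sumℚ l × sumᵥ (λ j → l (punchIn j* j) ·ᵥ p (punchIn j* j)) ≈ᵥ sumᵥ (λ j → l j ·ᵥ p j)
drop-zero-weight p l j* lj*≡0 =
  trans (sym (ℚP.+-identityˡ _)) (trans (cong (_+ sumℚ (l ∘ punchIn j*)) (sym lj*≡0)) (sym (sumℚ-remove l j*))) ,
  λ i → trans (sumᵥ-apply (λ j → l (punchIn j* j) ·ᵥ p (punchIn j* j)) i)
        (trans (sym (ℚP.+-identityˡ _))
        (trans (cong (_+ sumℚ ((λ j → l j * p j i) ∘ punchIn j*)) (sym (trans (cong (_* p j* i) lj*≡0) (ℚP.*-zeroˡ (p j* i)))))
        (trans (sym (sumℚ-remove (λ j → l j * p j i) j*)) (sym (sumᵥ-apply (λ j → l j ·ᵥ p j) i)))))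

-- Move along the dependence until the first weight hits zero, then drop that point.
drop-point : ∀ {k d} (p : Fin (suc k) → Vecℚ d) (l : Fin (suc k) → ℚ) → (∀ j → 0ℚ ≤ l j) →
  (∃ λ μ → AffineDependence p μ × ∃ λ j → 0ℚ < μ j) →
  Σ (Fin (suc k)) λ j* → Σ (Fin k → ℚ) λ l′ → (∀ j → 0ℚ ≤ l′ j) × (sumℚ l′ ≡ sumℚ l) ×
    (sumᵥ (λ j → l′ j ·ᵥ p (punchIn j* j)) ≈ᵥ sumᵥ (λ j → l j ·ᵥ p j))
drop-point {k} p l l≥0 (μ , dep , j₀ , μj₀>0) with minimiser μ (λ j → l j * inv (μ j))
... | inj₁ none = ⊥-elim (none j₀ μj₀>0)
... | inj₂ (j* , μj*>0 , min) =
  j* , l′ ∘ punchIn j* , l′≥0 ∘ punchIn j* ,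
  trans (proj₁ dropped) (shift-sum p μ dep l t) ,
  ≈ᵥ-trans (proj₂ dropped) (shift-combination p μ dep l t)
  where
  ratio = λ j → l j * inv (μ j)
  t = ratio j*
  l′ : Fin (suc k) → ℚ
  l′ j = l j + - t * μ j
  ratio*μ : ∀ j → 0ℚ < μ j → ratio j * μ j ≡ l j
  ratio*μ j μj>0 = trans (solve 3 (λ a b c → a :* b :* c := a :* (c :* b)) refl (l j) (inv (μ j)) (μ j))
                         (trans (cong (l j *_) (*-inv (μ j) (>0⇒≢0 μj>0))) (ℚP.*-identityʳ (l j)))
  l′≥0 : ∀ j → 0ℚ ≤ l′ j
  l′≥0 j with 0ℚ ℚP.<? μ j
  ... | yes μj>0 = subst (0ℚ ≤_) (cong (l j +_) (ℚP.neg-distribˡ-* t (μ j)))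
                         (p≤q⇒0≤q-p (subst (t * μ j ≤_) (ratio*μ j μj>0)
                                               (ℚP.*-monoʳ-≤-nonNeg (μ j) {{ℚ.nonNegative (ℚP.<⇒≤ μj>0)}} (min j μj>0))))
  ... | no μj≯0 = ℚP.+-mono-≤ (l≥0 j) (subst (0ℚ ≤_) (solve 2 (λ t m → t :* (:- m) := (:- t) :* m) refl t (μ j))
                                                      (*-nonNeg t≥0 (ℚP.neg-antimono-≤ (ℚP.≮⇒≥ μj≯0))))
    where t≥0 = *-nonNeg (l≥0 j*) (ℚP.<⇒≤ (inv-pos (μ j*) μj*>0))
  dropped = drop-zero-weight p l′ j* (trans (cong (l j* +_) (sym (ℚP.neg-distribˡ-* t (μ j*))))
                                            (trans (cong (λ z → l j* + - z) (ratio*μ j* μj*>0)) (ℚP.+-inverseʳ (l j*))))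

DimAtMost-Conv : ∀ {d} {S : Subset d} n → DimAtMost (Conv S) n → DimAtMost S n
DimAtMost-Conv {S = S} n dim k p p∈S = dim k p (λ j → Cone⇒Conv (Cone-gen {S = S} (p∈S j)))

module _ {d : ℕ} {S : Subset d} (n : ℕ) (dim : DimAtMost S n) where

  caratheodory-combination : ∀ k (p : Fin k → Vecℚ d) (l : Fin k → ℚ) → (∀ j → S (p j)) → (∀ j → 0ℚ ≤ l j) →
    Σ (Cone S (sumℚ l) (sumᵥ (λ j → l j ·ᵥ p j))) λ c → Cone.size c ℕ.≤ suc n
  caratheodory-combination k p l p∈S l≥0 with k ℕ.≤? suc n
  ... | yes k≤ = cone p l p∈S l≥0 refl (λ _ → refl) , k≤
  caratheodory-combination zero p l p∈S l≥0 | no k≰ = ⊥-elim (k≰ ℕ.z≤n)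
  caratheodory-combination (suc k) p l p∈S l≥0 | no k≰ with affinelyIndependent⊎dependent p
  ... | inj₁ indep = ⊥-elim (k≰ (dim (suc k) p p∈S indep))
  ... | inj₂ dep with drop-point p l l≥0 dep
  ...   | j* , l′ , l′≥0 , Σl′ , l′p≈ with caratheodory-combination k (p ∘ punchIn j*) l′ (p∈S ∘ punchIn j*) l′≥0
  ...     | c , size≤ = Cone-resp-≈ l′p≈ (Cone-resp-weight Σl′ c) , size≤

  caratheodory : ∀ {t x} → Cone S t x → Σ (Cone S t x) λ c → Cone.size c ℕ.≤ suc n
  caratheodory (cone p l p∈S l≥0 Σl x≈) with caratheodory-combination _ p l p∈S l≥0
  ... | c , size≤ = Cone-resp-≈ (≈ᵥ-sym x≈) (Cone-resp-weight Σl c) , size≤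

-- Peeling a lattice point off a dilate

nonNeg-floor : ∀ q → 0ℚ ≤ q → Σ ℕ λ g → ℕtoℚ g ≤ q × q < ℕtoℚ (suc g)
nonNeg-floor (mkℚ (ℤ.+ p) d-1 c) _ = g , g≤q , q<g+1
  where
  d = suc d-1
  g = p DivMod./ d
  g≤q : ℕtoℚ g ≤ mkℚ (ℤ.+ p) d-1 c
  g≤q rewrite /1≡fromℤ (ℤ.+ g) =
    ℚ.*≤* (subst₂ ℤ._≤_ (ℤP.pos-* g d) (ℤP.pos-* p 1)
                  (ℤ.+≤+ (subst (g ℕ.* d ℕ.≤_) (sym (ℕP.*-identityʳ p)) (DivMod.m/n*n≤m p d))))
  q<g+1 : mkℚ (ℤ.+ p) d-1 c < ℕtoℚ (suc g)
  q<g+1 rewrite /1≡fromℤ (ℤ.+ suc g) =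
    ℚ.*<* (subst₂ ℤ._<_ (ℤP.pos-* p 1) (ℤP.pos-* (suc g) d)
                  (ℤ.+<+ (subst (ℕ._< suc g ℕ.* d) (sym (ℕP.*-identityʳ p))
                                (subst (ℕ._< d ℕ.+ g ℕ.* d) (sym (DivMod.m≡m%n+[m/n]*n p d))
                                       (ℕP.+-monoˡ-< (g ℕ.* d) (DivMod.m%n<n p d))))))
nonNeg-floor (mkℚ ℤ.-[1+ p ] _ _) (ℚ.*≤* ())

sum<1-bound : ∀ {k} n (f : Fin k → ℚ) → k ℕ.≤ suc n → (∀ j → f j < 1ℚ) → sumℚ f < ℕtoℚ (suc n)
sum<1-bound {zero} n f _ _ = ℕtoℚ-pos (suc n) (ℕ.s≤s ℕ.z≤n)
sum<1-bound {suc zero} zero f _ f<1 = subst (_< 1ℚ) (sym (ℚP.+-identityʳ (f zero))) (f<1 zero)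
sum<1-bound {suc k} (suc n) f (ℕ.s≤s k≤) f<1 =
  subst (sumℚ f <_) (sym (ℕtoℚ-homo-+ 1 (suc n))) (ℚP.+-mono-< (f<1 zero) (sum<1-bound n (f ∘ suc) k≤ (f<1 ∘ suc)))

part-of-sum : ∀ {k} (g : Fin k → ℕ) t → t ℕ.≤ sumℕ g → Σ (Fin k → ℕ) λ g′ → (∀ j → g′ j ℕ.≤ g j) × sumℕ g′ ≡ t
part-of-sum {zero} g .0 ℕ.z≤n = (λ ()) , (λ ()) , refl
part-of-sum {suc k} g t t≤Σg with t ℕ.≤? g zero
... | yes t≤g₀ = (λ { zero → t ; (suc j) → 0 }) , (λ { zero → t≤g₀ ; (suc j) → ℕ.z≤n }) ,
                 trans (cong (t ℕ.+_) (sum-replicate-zero k)) (ℕP.+-identityʳ t)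
... | no t≰g₀ with part-of-sum (g ∘ suc) (t ℕ.∸ g zero) (ℕP.m≤n+o⇒m∸n≤o t (g zero) t≤Σg)
...   | g′ , g′≤g , Σg′ = (λ { zero → g zero ; (suc j) → g′ j }) , (λ { zero → ℕP.≤-refl ; (suc j) → g′≤g j }) ,
                          trans (cong (g zero ℕ.+_) Σg′) (ℕP.m+[n∸m]≡n (ℕP.<⇒≤ (ℕP.≰⇒> t≰g₀)))

record WeightSplit {k} (n c : ℕ) (l : Fin k → ℚ) : Set where
  constructor weightSplit
  field
    w : Fin k → ℚ
    h : Fin k → ℕ
    l≡w+h : ∀ j → l j ≡ w j + ℕtoℚ (h j)
    w≥0 : ∀ j → 0ℚ ≤ w j
    Σw : sumℚ w ≡ ℕtoℚ n
    Σh : sumℚ (ℕtoℚ ∘ h) ≡ ℕtoℚ (c ℕ.* n)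

-- The fractional parts of at most n + 1 weights have mass below n + 1, so the integer
-- parts of weights of integral total mass n + c n have mass at least c n.
split-weights : ∀ {k} n c (l : Fin k → ℚ) → k ℕ.≤ suc n → (∀ j → 0ℚ ≤ l j) → sumℚ l ≡ ℕtoℚ (suc c ℕ.* n) →
                WeightSplit n c l
split-weights {k} n c l k≤ l≥0 Σl = weightSplit w h l≡w+h w≥0 Σw Σh
  where
  g : Fin k → ℕ
  g j = proj₁ (nonNeg-floor (l j) (l≥0 j))
  g≤l : ∀ j → ℕtoℚ (g j) ≤ l j
  g≤l j = proj₁ (proj₂ (nonNeg-floor (l j) (l≥0 j)))
  frac<1 : ∀ j → l j + - ℕtoℚ (g j) < 1ℚ
  frac<1 j = subst (l j + - ℕtoℚ (g j) <_)
                   (trans (cong (_+ - ℕtoℚ (g j)) (ℕtoℚ-homo-+ 1 (g j))) (solve 2 (λ o a → o :+ a :+ (:- a) := o) refl 1ℚ (ℕtoℚ (g j))))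
                   (ℚP.+-monoˡ-< (- ℕtoℚ (g j)) (proj₂ (proj₂ (nonNeg-floor (l j) (l≥0 j)))))
  M = suc c ℕ.* n
  G = sumℕ g
  Σfrac : sumℚ (λ j → l j + - ℕtoℚ (g j)) ≡ ℕtoℚ M + - ℕtoℚ G
  Σfrac = trans (sumℚ-distrib-+ l (λ j → - ℕtoℚ (g j))) (cong₂ _+_ Σl (trans (sumℚ-neg (ℕtoℚ ∘ g)) (cong -_ (sumℚ-ℕtoℚ g))))
  M<n+1+G : M ℕ.< suc n ℕ.+ G
  M<n+1+G = ℕtoℚ-cancel-< M (suc n ℕ.+ G)
              (subst₂ _<_ (solve 2 (λ m g → m :+ (:- g) :+ g := m) refl (ℕtoℚ M) (ℕtoℚ G)) (sym (ℕtoℚ-homo-+ (suc n) G))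
                      (ℚP.+-monoˡ-< (ℕtoℚ G) (subst (_< ℕtoℚ (suc n)) Σfrac (sum<1-bound n _ k≤ frac<1))))
  cn≤G : c ℕ.* n ℕ.≤ G
  cn≤G = ℕP.+-cancelˡ-≤ n (c ℕ.* n) G (ℕP.≤-pred M<n+1+G)
  h : Fin k → ℕ
  h = proj₁ (part-of-sum g (c ℕ.* n) cn≤G)
  h≤g : ∀ j → h j ℕ.≤ g j
  h≤g = proj₁ (proj₂ (part-of-sum g (c ℕ.* n) cn≤G))
  Σh : sumℚ (ℕtoℚ ∘ h) ≡ ℕtoℚ (c ℕ.* n)
  Σh = trans (sumℚ-ℕtoℚ h) (cong ℕtoℚ (proj₂ (proj₂ (part-of-sum g (c ℕ.* n) cn≤G))))
  w : Fin k → ℚ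
  w j = l j + - ℕtoℚ (h j)
  w≥0 : ∀ j → 0ℚ ≤ w j
  w≥0 j = p≤q⇒0≤q-p (ℚP.≤-trans (ℕtoℚ-mono-≤ (h j) (g j) (h≤g j)) (g≤l j))
  l≡w+h : ∀ j → l j ≡ w j + ℕtoℚ (h j)
  l≡w+h j = solve 2 (λ l h → l := l :+ (:- h) :+ h) refl (l j) (ℕtoℚ (h j))
  Σw : sumℚ w ≡ ℕtoℚ n
  Σw = begin
    sumℚ w
      ≡⟨ sumℚ-distrib-+ l (λ j → - ℕtoℚ (h j)) ⟩
    sumℚ l + sumℚ (λ j → - ℕtoℚ (h j))
      ≡⟨ cong₂ _+_ Σl (trans (sumℚ-neg (ℕtoℚ ∘ h)) (cong -_ Σh)) ⟩
    ℕtoℚ (n ℕ.+ c ℕ.* n) + - ℕtoℚ (c ℕ.* n)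
      ≡⟨ cong (_+ - ℕtoℚ (c ℕ.* n)) (ℕtoℚ-homo-+ n (c ℕ.* n)) ⟩
    ℕtoℚ n + ℕtoℚ (c ℕ.* n) + - ℕtoℚ (c ℕ.* n)
      ≡⟨ solve 2 (λ a b → a :+ b :+ (:- b) := a) refl (ℕtoℚ n) (ℕtoℚ (c ℕ.* n)) ⟩
    ℕtoℚ n ∎
    where open ≡-Reasoning

-- `LatticePolytope V` is `Conv (Generators V)`.
Generators : ∀ {d} → List (Vecℤ d) → Subset d
Generators V x = ∃[ v ] (v ∈ V × x ≈ᵥ toℚ v)

record Peeled {d} (Rest Lattice : Subset d) (x : Vecℚ d) : Set where
  constructor peeled
  field
    rest : Vecℚ d
    lattice-part : Vecℤ d
    rest∈ : Rest rest
    lattice-part∈ : Lattice (toℚ lattice-part)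
    split : x ≈ᵥ (rest +ᵥ toℚ lattice-part)

module _ {d : ℕ} (V : List (Vecℤ d)) (n c : ℕ) where

  peel-small-cone : ∀ {x} (γ : Cone (Generators V) (ℕtoℚ (suc c ℕ.* n)) x) → Cone.size γ ℕ.≤ suc n →
                    Peeled (Cone (Generators V) (ℕtoℚ n)) (Cone (Generators V) (ℕtoℚ (c ℕ.* n))) x
  peel-small-cone {x} γ k≤ = peeled y r (cone points w points∈S w≥0 Σw (λ _ → refl)) r∈ x≈y+r
    where
    open Cone γ
    open WeightSplit (split-weights n c weights k≤ weights≥0 weights-sum)
    v : Fin size → Vecℤ d
    v j = proj₁ (points∈S j)
    p≈v : ∀ j → points j ≈ᵥ toℚ (v j)
    p≈v j = proj₂ (proj₂ (points∈S j))
    y = sumᵥ (λ j → w j ·ᵥ points j)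
    r = sumᶻ (λ j i → ℤ.+ h j ℤ.* v j i)
    r≈ : toℚ r ≈ᵥ sumᵥ (λ j → ℕtoℚ (h j) ·ᵥ points j)
    r≈ i = trans (toℚ-sumᶻ (λ j i → ℤ.+ h j ℤ.* v j i) i)
                 (sumᵥ-cong (λ j i′ → trans (/1-homo-* (ℤ.+ h j) (v j i′)) (cong (ℕtoℚ (h j) *_) (sym (p≈v j i′)))) i)
    r∈ : Cone (Generators V) (ℕtoℚ (c ℕ.* n)) (toℚ r)
    r∈ = cone points (ℕtoℚ ∘ h) points∈S (ℕtoℚ-nonNeg ∘ h) Σh r≈
    x≈y+r : x ≈ᵥ (y +ᵥ toℚ r)
    x≈y+r i = begin
      x i
        ≡⟨ combination i ⟩
      sumᵥ (λ j → weights j ·ᵥ points j) i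
        ≡⟨ sumᵥ-cong (λ j i′ → trans (cong (_* points j i′) (l≡w+h j)) (ℚP.*-distribʳ-+ (points j i′) (w j) (ℕtoℚ (h j)))) i ⟩
      sumᵥ (λ j → (w j ·ᵥ points j) +ᵥ (ℕtoℚ (h j) ·ᵥ points j)) i
        ≡⟨ sumᵥ-distrib-+ (λ j → w j ·ᵥ points j) (λ j → ℕtoℚ (h j) ·ᵥ points j) i ⟩
      y i + sumᵥ (λ j → ℕtoℚ (h j) ·ᵥ points j) i
        ≡⟨ cong (y i +_) (sym (r≈ i)) ⟩
      y i + toℚ r i ∎
      where open ≡-Reasoning

  peel-lattice-point : DimAtMost (LatticePolytope V) n → ∀ {x} → Cone (Generators V) (ℕtoℚ (suc c ℕ.* n)) x →
                       Peeled (Cone (Generators V) (ℕtoℚ n)) (Cone (Generators V) (ℕtoℚ (c ℕ.* n))) x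
  peel-lattice-point dim x∈ = uncurry peel-small-cone (caratheodory n (DimAtMost-Conv {S = Generators V} n dim) x∈)

-- Sums of dilates

record ConeSum {m d} (G : Fin m → Subset d) (μ : Fin m → ℚ) (y : Vecℚ d) : Set where
  constructor coneSum
  field
    parts : Fin m → Vecℚ d
    parts∈ : ∀ i → Cone (G i) (μ i) (parts i)
    sum-parts : y ≈ᵥ sumᵥ parts

module _ {m d : ℕ} {G : Fin m → Subset d} where

  ConeSum-resp-≈ : ∀ {μ x y} → x ≈ᵥ y → ConeSum G μ x → ConeSum G μ y
  ConeSum-resp-≈ x≈y (coneSum ys ys∈ x≈) = coneSum ys ys∈ (≈ᵥ-trans (≈ᵥ-sym x≈y) x≈)

  ConeSum-resp-weights : ∀ {μ ν y} → (∀ i → μ i ≡ ν i) → ConeSum G μ y → ConeSum G ν y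
  ConeSum-resp-weights μ≡ν (coneSum ys ys∈ y≈) = coneSum ys (λ i → Cone-resp-weight (μ≡ν i) (ys∈ i)) y≈

  ConeSum-+ : ∀ {μ ν x y} → ConeSum G μ x → ConeSum G ν y → ConeSum G (λ i → μ i + ν i) (x +ᵥ y)
  ConeSum-+ (coneSum xs xs∈ x≈) (coneSum ys ys∈ y≈) =
    coneSum (λ i → xs i +ᵥ ys i) (λ i → Cone-+ (xs∈ i) (ys∈ i))
            (λ k → trans (cong₂ _+_ (x≈ k) (y≈ k)) (sym (sumᵥ-distrib-+ xs ys k)))

  ConeSum-scale : ∀ {μ y} (a : ℚ) → 0ℚ ≤ a → ConeSum G μ y → ConeSum G (λ i → a * μ i) (a ·ᵥ y)
  ConeSum-scale a 0≤a (coneSum ys ys∈ y≈) =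
    coneSum (λ i → a ·ᵥ ys i) (λ i → Cone-scale a 0≤a (ys∈ i))
            (λ k → trans (cong (a *_) (y≈ k)) (sym (sumᵥ-*ˡ a ys k)))

  ConeSum-unscale : ∀ (C : ℚ) → 0ℚ < C → ∀ {μ y} → ConeSum G (λ i → C * μ i) y →
                    Σ (Vecℚ d) λ u → ConeSum G μ u × (y ≈ᵥ (C ·ᵥ u))
  ConeSum-unscale C 0<C {μ} {y} c =
    inv C ·ᵥ y ,
    ConeSum-resp-weights (inv-cancelʳ C (>0⇒≢0 0<C) ∘ μ) (ConeSum-scale (inv C) (ℚP.<⇒≤ (inv-pos C 0<C)) c) ,
    λ k → sym (inv-cancelˡ C (>0⇒≢0 0<C) (y k))

𝟙 : Bool → ℕ
𝟙 true = 1
𝟙 false = 0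

nonzero? : ℕ → Bool
nonzero? zero = false
nonzero? (suc _) = true

pred+𝟙-nonzero? : ∀ k → ℕ.pred k ℕ.+ 𝟙 (nonzero? k) ≡ k
pred+𝟙-nonzero? zero = refl
pred+𝟙-nonzero? (suc k) = ℕP.+-comm k 1

module _ {m N : ℕ} (P : Fin m → List (Vecℤ N)) (n : Fin m → ℕ) where

  Q : Fin m → Subset N
  Q i = n i ⊙ LatticePolytope (P i)

  -- `ΣDilates k y`: y lies in k₁ Q₁ + ⋯ + kₘ Qₘ, written through the generators of the Pᵢ.
  ΣDilates : (Fin m → ℕ) → Vecℚ N → Set
  ΣDilates k = ConeSum (Generators ∘ P) (λ i → ℕtoℚ (k i ℕ.* n i))

  ΣDilates-resp-mult : ∀ {k k′ y} → (∀ i → k i ≡ k′ i) → ΣDilates k y → ΣDilates k′ y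
  ΣDilates-resp-mult k≡k′ = ConeSum-resp-weights (λ i → cong (λ a → ℕtoℚ (a ℕ.* n i)) (k≡k′ i))

  ΣDilates-+ : ∀ {k k′ x y} → ΣDilates k x → ΣDilates k′ y → ΣDilates (λ i → k i ℕ.+ k′ i) (x +ᵥ y)
  ΣDilates-+ {k} {k′} x∈ y∈ = ConeSum-resp-weights weights (ConeSum-+ x∈ y∈)
    where
    weights : ∀ i → ℕtoℚ (k i ℕ.* n i) + ℕtoℚ (k′ i ℕ.* n i) ≡ ℕtoℚ ((k i ℕ.+ k′ i) ℕ.* n i)
    weights i = trans (sym (ℕtoℚ-homo-+ (k i ℕ.* n i) (k′ i ℕ.* n i))) (cong ℕtoℚ (sym (ℕP.*-distribʳ-+ (n i) (k i) (k′ i))))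

  ΣDilates-scale : ∀ c {k y} → ΣDilates k y → ΣDilates (λ i → c ℕ.* k i) (ℕtoℚ c ·ᵥ y)
  ΣDilates-scale c {k} y∈ = ConeSum-resp-weights weights (ConeSum-scale (ℕtoℚ c) (ℕtoℚ-nonNeg c) y∈)
    where
    weights : ∀ i → ℕtoℚ c * ℕtoℚ (k i ℕ.* n i) ≡ ℕtoℚ (c ℕ.* k i ℕ.* n i)
    weights i = trans (sym (ℕtoℚ-homo-* c (k i ℕ.* n i))) (cong ℕtoℚ (sym (ℕP.*-assoc c (k i) (n i))))

  ΣDilates-unscale : ∀ c → 1 ℕ.≤ c → ∀ {k y} → ΣDilates (λ i → c ℕ.* k i) y →
                     Σ (Vecℚ N) λ u → ΣDilates k u × (y ≈ᵥ (ℕtoℚ c ·ᵥ u))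
  ΣDilates-unscale c 1≤c {k} y∈ = ConeSum-unscale (ℕtoℚ c) (ℕtoℚ-pos c 1≤c) (ConeSum-resp-weights weights y∈)
    where
    weights : ∀ i → ℕtoℚ (c ℕ.* k i ℕ.* n i) ≡ ℕtoℚ c * ℕtoℚ (k i ℕ.* n i)
    weights i = trans (cong ℕtoℚ (ℕP.*-assoc c (k i) (n i))) (ℕtoℚ-homo-* c (k i ℕ.* n i))

  MinkSumOver⇒ΣDilates : ∀ {I y} → MinkSumOver I Q y → ΣDilates (𝟙 ∘ I) y
  MinkSumOver⇒ΣDilates {I} (ys , ys∈Q , ys≈0 , y≈) = coneSum ys part y≈
    where
    part : ∀ i → Cone (Generators (P i)) (ℕtoℚ (𝟙 (I i) ℕ.* n i)) (ys i)
    part i with I i | ys∈Q i | ys≈0 i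
    ... | true | y∈Q | _ = Cone-resp-weight (cong ℕtoℚ (sym (ℕP.+-identityʳ (n i)))) (⊙Conv⇒Cone (n i) (y∈Q tt))
    ... | false | _ | y≈0 = Cone-resp-≈ (≈ᵥ-sym (y≈0 tt)) Cone-zero

  module _ (n≥1 : ∀ i → 1 ℕ.≤ n i) where

    ΣDilates⇒MinkSumOver : ∀ {I y} → ΣDilates (𝟙 ∘ I) y → MinkSumOver I Q y
    ΣDilates⇒MinkSumOver {I} (coneSum ys ys∈ y≈) = ys , ys∈Q , ys≈0 , y≈
      where
      ys∈Q : ∀ i → T (I i) → Q i (ys i)
      ys∈Q i _ with I i | ys∈ i
      ... | true | y∈ = Cone⇒⊙Conv (n i) (n≥1 i) (Cone-resp-weight (cong ℕtoℚ (ℕP.+-identityʳ (n i))) y∈)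
      ys≈0 : ∀ i → T (not (I i)) → ys i ≈ᵥ 0ᵥ
      ys≈0 i _ with I i | ys∈ i
      ... | false | y∈ = Cone-weight-0 y∈

  module _ (dim : ∀ i → DimAtMost (LatticePolytope (P i)) (n i)) where

    peel-part : ∀ i k {x} → Cone (Generators (P i)) (ℕtoℚ (k ℕ.* n i)) x →
      Peeled (Cone (Generators (P i)) (ℕtoℚ (𝟙 (nonzero? k) ℕ.* n i))) (Cone (Generators (P i)) (ℕtoℚ (ℕ.pred k ℕ.* n i))) x
    peel-part i zero x∈ = peeled 0ᵥ 0ᶻ Cone-zero Cone-zero (λ j → trans (Cone-weight-0 x∈ j) (sym (ℚP.+-identityˡ 0ℚ)))
    peel-part i (suc k) x∈ =
      peeled rest lattice-part (Cone-resp-weight (cong ℕtoℚ (sym (ℕP.+-identityʳ (n i)))) rest∈) lattice-part∈ split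
      where open Peeled (peel-lattice-point (P i) (n i) k (dim i) x∈)

    ΣDilates-peel : ∀ a {x} → ΣDilates a x → Peeled (ΣDilates (𝟙 ∘ nonzero? ∘ a)) (ΣDilates (ℕ.pred ∘ a)) x
    ΣDilates-peel a {x} (coneSum xs xs∈ x≈) =
      peeled (sumᵥ ys) (sumᶻ rs) (coneSum ys (Peeled.rest∈ ∘ part) (λ _ → refl))
             (coneSum (toℚ ∘ rs) (Peeled.lattice-part∈ ∘ part) (toℚ-sumᶻ rs)) x≈y+r
      where
      part = λ i → peel-part i (a i) (xs∈ i)
      ys = Peeled.rest ∘ part
      rs = Peeled.lattice-part ∘ part
      x≈y+r : x ≈ᵥ (sumᵥ ys +ᵥ toℚ (sumᶻ rs))
      x≈y+r j = begin
        x j                                      ≡⟨ x≈ j ⟩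
        sumᵥ xs j                                ≡⟨ sumᵥ-cong (Peeled.split ∘ part) j ⟩
        sumᵥ (λ i → ys i +ᵥ toℚ (rs i)) j         ≡⟨ sumᵥ-distrib-+ ys (toℚ ∘ rs) j ⟩
        sumᵥ ys j + sumᵥ (toℚ ∘ rs) j            ≡⟨ cong (sumᵥ ys j +_) (sym (toℚ-sumᶻ rs j)) ⟩
        sumᵥ ys j + toℚ (sumᶻ rs) j              ∎
        where open ≡-Reasoning

-- Part (1)

Respects≈ : ∀ {d} → Subset d → Set
Respects≈ {d} S = ∀ {x y : Vecℚ d} → x ≈ᵥ y → S x → S y

IDPStep : ∀ {d} → Subset d → ℕ → Set
IDPStep {d} S c = ∀ (z : Vecℤ d) →
  LatPts (suc (suc c) ⊙ S) z ⇔ (∃[ a ] ∃[ b ] (LatPts (suc c ⊙ S) a × LatPts S b × z ≈ᶻ (a +ᶻ b)))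

IDP-intro : ∀ {d} (S : Subset d) → Respects≈ S → (∀ c → IDPStep S c) → IDP S
IDP-intro S resp step (suc (suc c)) _ = step c
IDP-intro S resp step (suc zero) _ z = mk⇔ to from
  where
  to : LatPts (1 ⊙ S) z → ∃[ a ] ∃[ b ] (LatPts (0 ⊙ S) a × LatPts S b × z ≈ᶻ (a +ᶻ b))
  to (y , y∈S , z≈y) =
    0ᶻ , z , (y , y∈S , λ k → sym (ℚP.*-zeroˡ (y k))) ,
    resp (λ k → sym (trans (z≈y k) (ℚP.*-identityˡ (y k)))) y∈S , λ k → sym (ℤP.+-identityˡ (z k))
  from : ∃[ a ] ∃[ b ] (LatPts (0 ⊙ S) a × LatPts S b × z ≈ᶻ (a +ᶻ b)) → LatPts (1 ⊙ S) z
  from (a , b , (y , _ , a≈0y) , b∈S , z≈a+b) = toℚ z , resp b≈z b∈S , λ k → sym (ℚP.*-identityˡ (toℚ z k))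
    where
    b≈z : toℚ b ≈ᵥ toℚ z
    b≈z k = sym (trans (cong (ℚ._/ 1) (z≈a+b k))
                       (trans (/1-homo-+ (a k) (b k))
                              (trans (cong (_+ toℚ b k) (trans (a≈0y k) (ℚP.*-zeroˡ (y k)))) (ℚP.+-identityˡ _))))

Conv-resp-≈ : ∀ {d} (S : Subset d) → Respects≈ (Conv S)
Conv-resp-≈ S x≈y x∈ = Cone⇒Conv (Cone-resp-≈ x≈y (Conv⇒Cone {S = S} x∈))

⊙-resp-≈ : ∀ {d} (k : ℕ) (S : Subset d) → Respects≈ (k ⊙ S)
⊙-resp-≈ k S x≈y (u , u∈S , x≈) = u , u∈S , ≈ᵥ-trans (≈ᵥ-sym x≈y) x≈

MinkSumOver-resp-≈ : ∀ {m d} (I : Fin m → Bool) (Q : Fin m → Subset d) → Respects≈ (MinkSumOver I Q)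
MinkSumOver-resp-≈ I Q x≈y (ys , ys∈ , ys≈0 , x≈) = ys , ys∈ , ys≈0 , ≈ᵥ-trans (≈ᵥ-sym x≈y) x≈

module _ {m N : ℕ} (P : Fin m → List (Vecℤ N)) (n : Fin m → ℕ) (n≥1 : ∀ i → 1 ℕ.≤ n i) where

  ⊙MinkSum⇒ΣDilates : ∀ c {y} → (c ⊙ MinkSum (Q P n)) y → ΣDilates P n (λ _ → c) y
  ⊙MinkSum⇒ΣDilates c (u , u∈ , y≈) =
    ConeSum-resp-≈ (≈ᵥ-sym y≈)
      (ΣDilates-resp-mult P n (λ _ → ℕP.*-identityʳ c) (ΣDilates-scale P n c (MinkSumOver⇒ΣDilates P n u∈)))

  ΣDilates⇒⊙MinkSum : ∀ c → 1 ℕ.≤ c → ∀ {y} → ΣDilates P n (λ _ → c) y → (c ⊙ MinkSum (Q P n)) y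
  ΣDilates⇒⊙MinkSum c 1≤c y∈ =
    map₂ (map₁ (ΣDilates⇒MinkSumOver P n n≥1))
         (ΣDilates-unscale P n c 1≤c (ΣDilates-resp-mult P n (λ _ → sym (ℕP.*-identityʳ c)) y∈))

  module _ (dim : ∀ i → DimAtMost (LatticePolytope (P i)) (n i)) where

    MinkSum-IDPStep : ∀ c → IDPStep (MinkSum (Q P n)) c
    MinkSum-IDPStep c z = mk⇔ to from
      where
      to : LatPts (suc (suc c) ⊙ MinkSum (Q P n)) z →
           ∃[ a ] ∃[ b ] (LatPts (suc c ⊙ MinkSum (Q P n)) a × LatPts (MinkSum (Q P n)) b × z ≈ᶻ (a +ᶻ b))
      to z∈ = lattice-part , z -ᶻ lattice-part ,
              ΣDilates⇒⊙MinkSum (suc c) (ℕ.s≤s ℕ.z≤n) lattice-part∈ ,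
              ΣDilates⇒MinkSumOver P n n≥1 (ConeSum-resp-≈ (≈ᵥ-sym (toℚ-[-ᶻ] z lattice-part split)) rest∈) ,
              +ᶻ-[-ᶻ] z lattice-part
        where open Peeled (ΣDilates-peel P n dim (λ _ → suc (suc c)) (⊙MinkSum⇒ΣDilates (suc (suc c)) z∈))
      from : ∃[ a ] ∃[ b ] (LatPts (suc c ⊙ MinkSum (Q P n)) a × LatPts (MinkSum (Q P n)) b × z ≈ᶻ (a +ᶻ b)) →
             LatPts (suc (suc c) ⊙ MinkSum (Q P n)) z
      from (a , b , a∈ , b∈ , z≈a+b) =
        ΣDilates⇒⊙MinkSum (suc (suc c)) (ℕ.s≤s ℕ.z≤n)
          (ConeSum-resp-≈ (λ k → sym (trans (cong (ℚ._/ 1) (z≈a+b k)) (toℚ-+ᶻ a b k)))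
            (ΣDilates-resp-mult P n (λ _ → ℕP.+-comm (suc c) 1)
              (ΣDilates-+ P n {k = λ _ → suc c} {k′ = λ _ → 1} (⊙MinkSum⇒ΣDilates (suc c) a∈) (MinkSumOver⇒ΣDilates P n b∈))))

    MinkSum-IDP : IDP (MinkSum (Q P n))
    MinkSum-IDP = IDP-intro (MinkSum (Q P n)) (MinkSumOver-resp-≈ _ (Q P n)) MinkSum-IDPStep

-- Cayley sums

≈ᵥ-++ : ∀ {m N} (X : Vecℚ (m ℕ.+ N)) (f : Vecℚ m) (g : Vecℚ N) →
        take m X ≈ᵥ f → drop m X ≈ᵥ g → X ≈ᵥ (f ++ g)
≈ᵥ-++ {m} {N} X f g take≈ drop≈ ι with splitAt m ι | FinP.join-splitAt m N ι
... | inj₁ i | ι≡ = trans (cong X (sym ι≡)) (take≈ i)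
... | inj₂ k | ι≡ = trans (cong X (sym ι≡)) (drop≈ k)

unitVec-diag : ∀ {m} (i : Fin m) → unitVec i i ≡ 1ℚ
unitVec-diag i with i ≟ i
... | yes _ = refl
... | no i≢i = ⊥-elim (i≢i refl)

unitVec-off : ∀ {m} (i j : Fin m) → i ≢ j → unitVec i j ≡ 0ℚ
unitVec-off i j i≢j with i ≟ j
... | yes i≡j = ⊥-elim (i≢j i≡j)
... | no _ = refl

unitVec-nonNeg : ∀ {m} (i j : Fin m) → 0ℚ ≤ unitVec i j
unitVec-nonNeg i j with i ≟ j
... | yes _ = 0≤1
... | no _ = ℚP.≤-refl

sumℚ-unitVec : ∀ {m} (i : Fin m) → sumℚ (unitVec i) ≡ 1ℚ
sumℚ-unitVec i = trans (sumℚ-single (unitVec i) i (λ j j≢i → unitVec-off i j (j≢i ∘ sym))) (unitVec-diag i)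

sumℚ-*-unitVec : ∀ {m} (c : Fin m → ℚ) (j : Fin m) → sumℚ (λ i → c i * unitVec i j) ≡ c j
sumℚ-*-unitVec c j =
  trans (sumℚ-single (λ i → c i * unitVec i j) j (λ i i≢j → trans (cong (c i *_) (unitVec-off i j i≢j)) (ℚP.*-zeroʳ (c i))))
        (trans (cong (c j *_) (unitVec-diag j)) (ℚP.*-identityʳ (c j)))

unitVecᶻ : ∀ {m} → Fin m → Vecℤ m
unitVecᶻ j = updateAt (λ _ → ℤ.+ 0) j (λ _ → ℤ.+ 1)

toℚ-unitVecᶻ : ∀ {m} (j : Fin m) → toℚ (unitVecᶻ j) ≈ᵥ unitVec j
toℚ-unitVecᶻ j i with i ≟ j
... | yes refl = trans (cong (ℚ._/ 1) (updateAt-updates j (λ _ → ℤ.+ 0))) (sym (unitVec-diag j))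
... | no i≢j = trans (cong (ℚ._/ 1) (updateAt-minimal i j (λ _ → ℤ.+ 0) i≢j)) (sym (unitVec-off j i (i≢j ∘ sym)))

pos-minus-unitVecᶻ : ∀ {m} (j : Fin m) (a : Fin m → ℕ) {t} → a j ≡ suc t → ∀ i →
                     ℤ.+ a i ℤ.- unitVecᶻ j i ≡ ℤ.+ updateAt a j ℕ.pred i
pos-minus-unitVecᶻ j a aj≡ i = cases i (i ≟ j)
  where
  cases : ∀ i → Dec (i ≡ j) → ℤ.+ a i ℤ.- unitVecᶻ j i ≡ ℤ.+ updateAt a j ℕ.pred i
  cases .j (yes refl) = trans (cong₂ ℤ._-_ (cong (λ k → ℤ.+ k) aj≡) (updateAt-updates j (λ _ → ℤ.+ 0)))
                              (cong (λ k → ℤ.+ k) (sym (trans (updateAt-updates j a) (cong ℕ.pred aj≡))))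
  cases i (no i≢j) = trans (cong (ℤ._-_ (ℤ.+ a i)) (updateAt-minimal i j (λ _ → ℤ.+ 0) i≢j))
                           (trans (ℤP.+-identityʳ (ℤ.+ a i)) (cong (λ k → ℤ.+ k) (sym (updateAt-minimal i j a i≢j))))

module _ {m N : ℕ} (P : Fin m → List (Vecℤ N)) (n : Fin m → ℕ) where

  CayleyGenerators : Subset (m ℕ.+ N)
  CayleyGenerators X = ∃[ i ] ∃[ q ] (Q P n i q × X ≈ᵥ (unitVec i ++ q))

  unitVecᶻ-++∈Cayley : ∀ j {q} → LatPts (Q P n j) q → LatPts (Cayley (Q P n)) (unitVecᶻ j ++ q)
  unitVecᶻ-++∈Cayley j {q} q∈ =
    Cone⇒Conv (Cone-gen {S = CayleyGenerators} (j , toℚ q , q∈ ,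
      ≈ᵥ-++ (toℚ (unitVecᶻ j ++ q)) (unitVec j) (toℚ q)
            (λ i → trans (cong (ℚ._/ 1) (lookup-++ˡ (unitVecᶻ j) q i)) (toℚ-unitVecᶻ j i))
            (λ k → cong (ℚ._/ 1) (lookup-++ʳ (unitVecᶻ j) q k))))

  -- X = (c, y) with c ≥ 0, Σ c = t and y ∈ Σᵢ cᵢ Qᵢ.
  record CayleyCone (t : ℚ) (X : Vecℚ (m ℕ.+ N)) : Set where
    constructor cayleyCone
    field
      coeffs : Fin m → ℚ
      coeffs≥0 : ∀ i → 0ℚ ≤ coeffs i
      coeffs-sum : sumℚ coeffs ≡ t
      take≈ : take m X ≈ᵥ coeffs
      drop∈ : ConeSum (Generators ∘ P) (λ i → coeffs i * ℕtoℚ (n i)) (drop m X)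

  CayleyCone-zero : CayleyCone 0ℚ 0ᵥ
  CayleyCone-zero =
    cayleyCone (λ _ → 0ℚ) (λ _ → ℚP.≤-refl) (sumℚ-zero {m} _ (λ _ → refl)) (λ _ → refl)
      (coneSum (λ _ → 0ᵥ) (λ i → Cone-resp-weight (sym (ℚP.*-zeroˡ (ℕtoℚ (n i)))) Cone-zero) (≈ᵥ-sym (sumᵥ-zero {m})))

  CayleyCone-+ : ∀ {s t X Y} → CayleyCone s X → CayleyCone t Y → CayleyCone (s + t) (X +ᵥ Y)
  CayleyCone-+ (cayleyCone c c≥0 Σc X≈ X∈) (cayleyCone c′ c′≥0 Σc′ Y≈ Y∈) =
    cayleyCone (λ i → c i + c′ i) (λ i → ℚP.+-mono-≤ (c≥0 i) (c′≥0 i)) (trans (sumℚ-distrib-+ c c′) (cong₂ _+_ Σc Σc′))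
      (λ i → cong₂ _+_ (X≈ i) (Y≈ i))
      (ConeSum-resp-weights (λ i → sym (ℚP.*-distribʳ-+ (ℕtoℚ (n i)) (c i) (c′ i))) (ConeSum-+ X∈ Y∈))

  CayleyCone-resp-≈ : ∀ {t X Y} → X ≈ᵥ Y → CayleyCone t X → CayleyCone t Y
  CayleyCone-resp-≈ X≈Y (cayleyCone c c≥0 Σc X≈ X∈) =
    cayleyCone c c≥0 Σc (λ i → trans (sym (X≈Y (i ↑ˡ N))) (X≈ i)) (ConeSum-resp-≈ (λ k → X≈Y (m ↑ʳ k)) X∈)

  CayleyCone-generator : ∀ {l X} → 0ℚ ≤ l → CayleyGenerators X → CayleyCone l (l ·ᵥ X)
  CayleyCone-generator {l} {X} 0≤l (i₀ , q , q∈Q , X≈) =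
    cayleyCone c (λ i → *-nonNeg 0≤l (unitVec-nonNeg i₀ i)) Σc
      (λ i → cong (l *_) (trans (X≈ (i ↑ˡ N)) (lookup-++ˡ (unitVec i₀) q i)))
      (coneSum (λ i → c i ·ᵥ q) (λ i → part i (i₀ ≟ i)) drop≈)
    where
    c : Fin m → ℚ
    c i = l * unitVec i₀ i
    Σc : sumℚ c ≡ l
    Σc = trans (sumℚ-*ˡ l (unitVec i₀)) (trans (cong (l *_) (sumℚ-unitVec i₀)) (ℚP.*-identityʳ l))
    c≡0 : ∀ i → i₀ ≢ i → c i ≡ 0ℚ
    c≡0 i i₀≢i = trans (cong (l *_) (unitVec-off i₀ i i₀≢i)) (ℚP.*-zeroʳ l)
    part : ∀ i → Dec (i₀ ≡ i) → Cone (Generators (P i)) (c i * ℕtoℚ (n i)) (c i ·ᵥ q)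
    part .i₀ (yes refl) = Cone-scale (c i₀) (*-nonNeg 0≤l (unitVec-nonNeg i₀ i₀)) (⊙Conv⇒Cone (n i₀) q∈Q)
    part i (no i₀≢i) =
      Cone-resp-weight (sym (trans (cong (_* ℕtoℚ (n i)) (c≡0 i i₀≢i)) (ℚP.*-zeroˡ (ℕtoℚ (n i)))))
        (Cone-resp-≈ (λ k → sym (trans (cong (_* q k) (c≡0 i i₀≢i)) (ℚP.*-zeroˡ (q k)))) Cone-zero)
    drop≈ : drop m (l ·ᵥ X) ≈ᵥ sumᵥ (λ i → c i ·ᵥ q)
    drop≈ k = begin
      l * X (m ↑ʳ k)                ≡⟨ cong (l *_) (trans (X≈ (m ↑ʳ k)) (lookup-++ʳ (unitVec i₀) q k)) ⟩
      l * q k                       ≡⟨ cong (_* q k) (sym Σc) ⟩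
      sumℚ c * q k                  ≡⟨ ℚP.*-comm (sumℚ c) (q k) ⟩
      q k * sumℚ c                  ≡⟨ sym (sumℚ-*ˡ (q k) c) ⟩
      sumℚ (λ i → q k * c i)        ≡⟨ sumℚ-cong (λ i → ℚP.*-comm (q k) (c i)) ⟩
      sumℚ (λ i → c i * q k)        ≡⟨ sym (sumᵥ-apply (λ i → c i ·ᵥ q) k) ⟩
      sumᵥ (λ i → c i ·ᵥ q) k       ∎
      where open ≡-Reasoning

  Cone⇒CayleyCone : ∀ {t X} → Cone CayleyGenerators t X → CayleyCone t X
  Cone⇒CayleyCone (cone {k} p l p∈ l≥0 Σl X≈) =
    CayleyCone-resp-≈ (≈ᵥ-sym X≈) (subst (λ t → CayleyCone t _) Σl (combination k p l p∈ l≥0))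
    where
    combination : ∀ k (p : Fin k → Vecℚ (m ℕ.+ N)) l → (∀ j → CayleyGenerators (p j)) → (∀ j → 0ℚ ≤ l j) →
                  CayleyCone (sumℚ l) (sumᵥ (λ j → l j ·ᵥ p j))
    combination zero p l p∈ l≥0 = CayleyCone-zero
    combination (suc k) p l p∈ l≥0 =
      CayleyCone-+ (CayleyCone-generator (l≥0 zero) (p∈ zero)) (combination k (p ∘ suc) (l ∘ suc) (p∈ ∘ suc) (l≥0 ∘ suc))

  -- X = (a, z) with a ∈ ℕᵐ, Σ a = s and z ∈ Σᵢ aᵢ Qᵢ.
  record CayleyLattice (s : ℕ) (X : Vecℤ (m ℕ.+ N)) : Set where
    constructor cayleyLattice
    field
      mult : Fin m → ℕ
      take≡ : ∀ i → X (i ↑ˡ N) ≡ ℤ.+ mult i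
      mult-sum : sumℕ mult ≡ s
      drop∈ : ΣDilates P n mult (toℚ (drop m X))

  ⊙Cayley⇒CayleyLattice : ∀ s X → LatPts (s ⊙ Cayley (Q P n)) X → CayleyLattice s X
  ⊙Cayley⇒CayleyLattice s X X∈ = cayleyLattice a take≡ Σa (ConeSum-resp-weights weights drop∈)
    where
    open CayleyCone (Cone⇒CayleyCone (⊙Conv⇒Cone s X∈))
    natural : ∀ i → ∃[ a ] X (i ↑ˡ N) ≡ ℤ.+ a
    natural i = nonNeg-/1⇒ℕ (X (i ↑ˡ N)) (subst (0ℚ ≤_) (sym (take≈ i)) (coeffs≥0 i))
    a : Fin m → ℕ
    a = proj₁ ∘ natural
    take≡ : ∀ i → X (i ↑ˡ N) ≡ ℤ.+ a i
    take≡ = proj₂ ∘ natural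
    coeffs≡a : ∀ i → coeffs i ≡ ℕtoℚ (a i)
    coeffs≡a i = trans (sym (take≈ i)) (cong (ℚ._/ 1) (take≡ i))
    Σa : sumℕ a ≡ s
    Σa = ℕtoℚ-injective (sumℕ a) s (trans (sym (sumℚ-ℕtoℚ a)) (trans (sumℚ-cong (sym ∘ coeffs≡a)) coeffs-sum))
    weights : ∀ i → coeffs i * ℕtoℚ (n i) ≡ ℕtoℚ (a i ℕ.* n i)
    weights i = trans (cong (_* ℕtoℚ (n i)) (coeffs≡a i)) (sym (ℕtoℚ-homo-* (a i) (n i)))

  module _ (n≥1 : ∀ i → 1 ℕ.≤ n i) where

    Cayley-part : ∀ i k {y} → Cone (Generators (P i)) (ℕtoℚ (k ℕ.* n i)) y →
                  Cone CayleyGenerators (ℕtoℚ k) ((ℕtoℚ k ·ᵥ unitVec i) ++ y)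
    Cayley-part i zero {y} y∈ =
      Cone-resp-≈ (≈ᵥ-++ 0ᵥ (0ℚ ·ᵥ unitVec i) y (λ j → sym (ℚP.*-zeroˡ (unitVec i j))) (λ k → sym (Cone-weight-0 y∈ k)))
                  Cone-zero
    Cayley-part i (suc k) {y} y∈ =
      Cone-resp-weight (ℚP.*-identityʳ (ℕtoℚ (suc k)))
        (Cone-resp-≈ scaled (Cone-scale (ℕtoℚ (suc k)) (ℕtoℚ-nonNeg (suc k)) (Cone-gen (i , u , u∈Q , λ _ → refl))))
      where
      unscaled = Cone-unscale (ℕtoℚ (suc k)) (ℕtoℚ-pos (suc k) (ℕ.s≤s ℕ.z≤n))
                              (Cone-resp-weight (ℕtoℚ-homo-* (suc k) (n i)) y∈)
      u = proj₁ unscaled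
      u∈Q : Q P n i u
      u∈Q = Cone⇒⊙Conv (n i) (n≥1 i) (proj₁ (proj₂ unscaled))
      scaled : (ℕtoℚ (suc k) ·ᵥ (unitVec i ++ u)) ≈ᵥ ((ℕtoℚ (suc k) ·ᵥ unitVec i) ++ y)
      scaled = ≈ᵥ-++ _ _ _ (λ j → cong (ℕtoℚ (suc k) *_) (lookup-++ˡ (unitVec i) u j))
                           (λ j → trans (cong (ℕtoℚ (suc k) *_) (lookup-++ʳ (unitVec i) u j)) (sym (proj₂ (proj₂ unscaled) j)))

    CayleyLattice⇒⊙Cayley : ∀ s → 1 ℕ.≤ s → ∀ {X} → CayleyLattice s X → LatPts (s ⊙ Cayley (Q P n)) X
    CayleyLattice⇒⊙Cayley s 1≤s {X} (cayleyLattice a take≡ Σa (coneSum ys ys∈ drop≈)) =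
      Cone⇒⊙Conv s 1≤s (Cone-resp-≈ (≈ᵥ-sym X≈)
        (Cone-resp-weight Σ-weights (Cone-sum (ℕtoℚ ∘ a) pts (λ i → Cayley-part i (a i) (ys∈ i)))))
      where
      pts : Fin m → Vecℚ (m ℕ.+ N)
      pts i = (ℕtoℚ (a i) ·ᵥ unitVec i) ++ ys i
      Σ-weights : sumℚ (ℕtoℚ ∘ a) ≡ ℕtoℚ s
      Σ-weights = trans (sumℚ-ℕtoℚ a) (cong ℕtoℚ Σa)
      X≈ : toℚ X ≈ᵥ sumᵥ pts
      X≈ = ≈ᵥ-trans (≈ᵥ-++ (toℚ X) (ℕtoℚ ∘ a) (sumᵥ ys) (λ i → cong (ℚ._/ 1) (take≡ i)) drop≈)
                    (≈ᵥ-sym (≈ᵥ-++ (sumᵥ pts) (ℕtoℚ ∘ a) (sumᵥ ys) take-pts drop-pts))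
        where
        take-pts : ∀ i → sumᵥ pts (i ↑ˡ N) ≡ ℕtoℚ (a i)
        take-pts i = trans (sumᵥ-apply pts (i ↑ˡ N))
                           (trans (sumℚ-cong (λ j → lookup-++ˡ (ℕtoℚ (a j) ·ᵥ unitVec j) (ys j) i)) (sumℚ-*-unitVec (ℕtoℚ ∘ a) i))
        drop-pts : ∀ k → sumᵥ pts (m ↑ʳ k) ≡ sumᵥ ys k
        drop-pts k = trans (sumᵥ-apply pts (m ↑ʳ k))
                           (trans (sumℚ-cong (λ j → lookup-++ʳ (ℕtoℚ (a j) ·ᵥ unitVec j) (ys j) k)) (sym (sumᵥ-apply ys k)))

-- Part (2)

sumℕ≡0⇒zero : ∀ {k} (a : Fin k → ℕ) → sumℕ a ≡ 0 → ∀ i → a i ≡ 0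
sumℕ≡0⇒zero a Σa≡0 zero = ℕP.m+n≡0⇒m≡0 (a zero) Σa≡0
sumℕ≡0⇒zero a Σa≡0 (suc i) = sumℕ≡0⇒zero (a ∘ suc) (ℕP.m+n≡0⇒n≡0 (a zero) Σa≡0) i

sumℕ≡suc⇒nonzero : ∀ {k} (a : Fin k → ℕ) {s} → sumℕ a ≡ suc s → ∃ λ j → ∃ λ t → a j ≡ suc t
sumℕ≡suc⇒nonzero {zero} a ()
sumℕ≡suc⇒nonzero {suc k} a Σa≡ with a zero in a₀≡
... | suc t = zero , t , a₀≡
... | zero with sumℕ≡suc⇒nonzero (a ∘ suc) Σa≡
...   | j , t , aj≡ = suc j , t , aj≡

aᵢ≤sumℕ : ∀ {k} (a : Fin k → ℕ) i → a i ℕ.≤ sumℕ a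
aᵢ≤sumℕ a zero = ℕP.m≤m+n (a zero) _
aᵢ≤sumℕ a (suc i) = ℕP.≤-trans (aᵢ≤sumℕ (a ∘ suc) i) (ℕP.m≤n+m _ (a zero))

sumℕ≡1⇒unit : ∀ {k} (a : Fin k → ℕ) → sumℕ a ≡ 1 → ∃ λ j → a j ≡ 1 × (∀ i → i ≢ j → a i ≡ 0)
sumℕ≡1⇒unit {zero} a ()
sumℕ≡1⇒unit {suc k} a Σa≡1 with sumℕ≡suc⇒nonzero a Σa≡1
... | j , t , aj≡ = j , trans aj≡ (cong suc t≡0) , others
  where
  Σ-split : suc t ℕ.+ sumℕ (removeAt a j) ≡ 1
  Σ-split = trans (cong (ℕ._+ sumℕ (removeAt a j)) (sym aj≡)) (trans (sym (sum-remove a)) Σa≡1)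
  t≡0 : t ≡ 0
  t≡0 = ℕP.m+n≡0⇒m≡0 t (ℕP.suc-injective Σ-split)
  rest≡0 : sumℕ (removeAt a j) ≡ 0
  rest≡0 = ℕP.m+n≡0⇒n≡0 t (ℕP.suc-injective Σ-split)
  others : ∀ i → i ≢ j → a i ≡ 0
  others i i≢j = trans (cong a (sym (FinP.punchIn-punchOut (i≢j ∘ sym))))
                       (sumℕ≡0⇒zero (removeAt a j) rest≡0 (punchOut (i≢j ∘ sym)))

sumℕ-updateAt-pred : ∀ {k} (a : Fin k → ℕ) j {t} → a j ≡ suc t → suc (sumℕ (updateAt a j ℕ.pred)) ≡ sumℕ a
sumℕ-updateAt-pred {suc k} a j {t} aj≡ = begin
  suc (sumℕ (updateAt a j ℕ.pred))
    ≡⟨ cong suc (sum-remove (updateAt a j ℕ.pred)) ⟩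
  suc (updateAt a j ℕ.pred j ℕ.+ sumℕ (removeAt (updateAt a j ℕ.pred) j))
    ≡⟨ cong₂ (λ x y → suc (x ℕ.+ y)) (trans (updateAt-updates j a) (cong ℕ.pred aj≡)) (sum-cong-≗ rest≗) ⟩
  suc (t ℕ.+ sumℕ (removeAt a j))
    ≡⟨ cong (ℕ._+ sumℕ (removeAt a j)) (sym aj≡) ⟩
  a j ℕ.+ sumℕ (removeAt a j)
    ≡⟨ sym (sum-remove a) ⟩
  sumℕ a ∎
  where
  open ≡-Reasoning
  rest≗ : ∀ i → removeAt (updateAt a j ℕ.pred) j i ≡ removeAt a j i
  rest≗ i = updateAt-minimal (punchIn j i) j a (FinP.punchInᵢ≢i j i)

𝟙≡0⇒false : ∀ b → 𝟙 b ≡ 0 → T (not b)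
𝟙≡0⇒false false _ = tt

𝟙≡suc⇒true : ∀ b {a} → 𝟙 b ≡ suc a → T b × a ≡ 0
𝟙≡suc⇒true true refl = tt , refl

T⇒𝟙≡1 : ∀ {b} → T b → 𝟙 b ≡ 1
T⇒𝟙≡1 {true} _ = refl

T-not⇒¬T : ∀ {b} → T (not b) → T b → ⊥
T-not⇒¬T {false} _ ()

_without_ : ∀ {m} → (Fin m → Bool) → Fin m → Fin m → Bool
I without j = updateAt I j (λ _ → false)

without-diag : ∀ {m} (I : Fin m → Bool) j → (I without j) j ≡ false
without-diag I j = updateAt-updates j I

without-off : ∀ {m} (I : Fin m → Bool) {i j} → i ≢ j → (I without j) i ≡ I i
without-off I {i} {j} i≢j = updateAt-minimal i j I i≢j

𝟙-without : ∀ {m} (I : Fin m → Bool) (a : Fin m → ℕ) j → 𝟙 (I j) ≡ suc (a j) → (∀ i → i ≢ j → 𝟙 (I i) ≡ a i) →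
            T (I j) × (∀ i → a i ≡ 𝟙 ((I without j) i))
𝟙-without I a j Ij≡ Ii≡ = proj₁ (𝟙≡suc⇒true (I j) Ij≡) , λ i → cases i (i ≟ j)
  where
  cases : ∀ i → Dec (i ≡ j) → a i ≡ 𝟙 ((I without j) i)
  cases .j (yes refl) = trans (proj₂ (𝟙≡suc⇒true (I j) Ij≡)) (cong 𝟙 (sym (without-diag I j)))
  cases i (no i≢j) = trans (sym (Ii≡ i i≢j)) (cong 𝟙 (sym (without-off I i≢j)))

pred+𝟙-without : ∀ {m} (a : Fin m → ℕ) j i → ℕ.pred (a i) ℕ.+ 𝟙 (((nonzero? ∘ a) without j) i) ≡ updateAt a j ℕ.pred i
pred+𝟙-without a j i = cases i (i ≟ j)
  where
  cases : ∀ i → Dec (i ≡ j) → ℕ.pred (a i) ℕ.+ 𝟙 (((nonzero? ∘ a) without j) i) ≡ updateAt a j ℕ.pred i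
  cases .j (yes refl) = trans (cong (λ b → ℕ.pred (a j) ℕ.+ 𝟙 b) (without-diag (nonzero? ∘ a) j))
                              (trans (ℕP.+-identityʳ (ℕ.pred (a j))) (sym (updateAt-updates j a)))
  cases i (no i≢j) = trans (cong (λ b → ℕ.pred (a i) ℕ.+ 𝟙 b) (without-off (nonzero? ∘ a) i≢j))
                           (trans (pred+𝟙-nonzero? (a i)) (sym (updateAt-minimal i j a i≢j)))

-- The right-hand side of `TupleIDP`.
LatticeSplit : ∀ {m d} → (Fin m → Subset d) → (Fin m → Bool) → Vecℤ d → Set
LatticeSplit {m} {d} Q I z =
  Σ (Fin m → Vecℤ d) λ b →
    (∀ i → T (I i) → LatPts (Q i) (b i)) × (∀ i → T (not (I i)) → b i ≈ᶻ 0ᶻ) × (z ≈ᶻ sumᶻ b)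

onlyAt : ∀ {m d} → Fin m → Vecℤ d → Fin m → Vecℤ d
onlyAt j q = updateAt (λ _ → 0ᶻ) j (λ _ → q)

onlyAt-diag : ∀ {m d} (j : Fin m) (q : Vecℤ d) → onlyAt j q j ≡ q
onlyAt-diag j q = updateAt-updates j (λ _ → 0ᶻ)

onlyAt-off : ∀ {m d} {i j : Fin m} (q : Vecℤ d) → i ≢ j → onlyAt j q i ≡ 0ᶻ
onlyAt-off {i = i} {j} q i≢j = updateAt-minimal i j (λ _ → 0ᶻ) i≢j

toℚ-sumᶻ-onlyAt : ∀ {m d} (j : Fin m) (q : Vecℤ d) → toℚ (sumᶻ (onlyAt j q)) ≈ᵥ toℚ q
toℚ-sumᶻ-onlyAt j q =
  ≈ᵥ-trans (toℚ-sumᶻ (onlyAt j q))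
    (≈ᵥ-trans (sumᵥ-single (toℚ ∘ onlyAt j q) j (λ i i≢j k → cong (λ v → v k ℚ./ 1) (onlyAt-off q i≢j)))
              (λ k → cong (λ v → v k ℚ./ 1) (onlyAt-diag j q)))

module _ {m d : ℕ} {Q : Fin m → Subset d} (Q-resp : ∀ i → Respects≈ (Q i)) where

  LatticeSplit-resp-≈ᶻ : ∀ {I z z′} → z ≈ᶻ z′ → LatticeSplit Q I z → LatticeSplit Q I z′
  LatticeSplit-resp-≈ᶻ z≈z′ (b , b∈ , b≈0 , z≈) = b , b∈ , b≈0 , λ k → trans (sym (z≈z′ k)) (z≈ k)

  LatticeSplit⇒MinkSumOver : ∀ {I z} → LatticeSplit Q I z → LatPts (MinkSumOver I Q) z
  LatticeSplit⇒MinkSumOver (b , b∈ , b≈0 , z≈) =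
    toℚ ∘ b , b∈ , (λ i i∉I k → cong (ℚ._/ 1) (b≈0 i i∉I k)) , λ k → trans (cong (ℚ._/ 1) (z≈ k)) (toℚ-sumᶻ b k)

  private
    sum-+-onlyAt : ∀ (b : Fin m → Vecℤ d) j q → toℚ (sumᶻ (λ i → b i +ᶻ onlyAt j q i)) ≈ᵥ (toℚ (sumᶻ b) +ᵥ toℚ q)
    sum-+-onlyAt b j q k = begin
      toℚ (sumᶻ (λ i → b i +ᶻ onlyAt j q i)) k
        ≡⟨ toℚ-sumᶻ (λ i → b i +ᶻ onlyAt j q i) k ⟩
      sumᵥ (λ i → toℚ (b i +ᶻ onlyAt j q i)) k
        ≡⟨ sumᵥ-cong (λ i → toℚ-+ᶻ (b i) (onlyAt j q i)) k ⟩
      sumᵥ (λ i → toℚ (b i) +ᵥ toℚ (onlyAt j q i)) k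
        ≡⟨ sumᵥ-distrib-+ (toℚ ∘ b) (toℚ ∘ onlyAt j q) k ⟩
      sumᵥ (toℚ ∘ b) k + sumᵥ (toℚ ∘ onlyAt j q) k
        ≡⟨ sym (cong₂ _+_ (toℚ-sumᶻ b k) (toℚ-sumᶻ (onlyAt j q) k)) ⟩
      toℚ (sumᶻ b) k + toℚ (sumᶻ (onlyAt j q)) k
        ≡⟨ cong (toℚ (sumᶻ b) k +_) (toℚ-sumᶻ-onlyAt j q k) ⟩
      toℚ (sumᶻ b) k + toℚ q k ∎
      where open ≡-Reasoning

  LatticeSplit-insert : ∀ {I z q} j → T (I j) → LatPts (Q j) q →
                        LatticeSplit Q (I without j) z → LatticeSplit Q I (z +ᶻ q)
  LatticeSplit-insert {I} {z} {q} j j∈I q∈Q (b , b∈ , b≈0 , z≈) = b′ , b′∈ , b′≈0 , z+q≈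
    where
    b′ : Fin m → Vecℤ d
    b′ i = b i +ᶻ onlyAt j q i
    b′j≈q : b′ j ≈ᶻ q
    b′j≈q k = trans (cong₂ ℤ._+_ (b≈0 j (subst (T ∘ not) (sym (without-diag I j)) tt) k) (cong (λ v → v k) (onlyAt-diag j q)))
                    (ℤP.+-identityˡ (q k))
    b′i≈bi : ∀ i → i ≢ j → b′ i ≈ᶻ b i
    b′i≈bi i i≢j k = trans (cong (λ v → b i k ℤ.+ v k) (onlyAt-off q i≢j)) (ℤP.+-identityʳ (b i k))
    b′∈ : ∀ i → T (I i) → LatPts (Q i) (b′ i)
    b′∈ i i∈I with i ≟ j
    ... | yes refl = Q-resp j (λ k → cong (ℚ._/ 1) (sym (b′j≈q k))) q∈Q
    ... | no i≢j = Q-resp i (λ k → cong (ℚ._/ 1) (sym (b′i≈bi i i≢j k)))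
                          (b∈ i (subst T (sym (without-off I i≢j)) i∈I))
    b′≈0 : ∀ i → T (not (I i)) → b′ i ≈ᶻ 0ᶻ
    b′≈0 i i∉I with i ≟ j
    ... | yes refl = ⊥-elim (T-not⇒¬T i∉I j∈I)
    ... | no i≢j = λ k → trans (b′i≈bi i i≢j k) (b≈0 i (subst (T ∘ not) (sym (without-off I i≢j)) i∉I) k)
    z+q≈ : (z +ᶻ q) ≈ᶻ sumᶻ b′
    z+q≈ = toℚ-injective (z +ᶻ q) (sumᶻ b′)
             (≈ᵥ-trans (toℚ-+ᶻ z q) (≈ᵥ-trans (λ k → cong (_+ toℚ q k) (cong (ℚ._/ 1) (z≈ k))) (≈ᵥ-sym (sum-+-onlyAt b j q))))

  LatticeSplit-remove : ∀ {I z} j (σ : LatticeSplit Q I z) → LatticeSplit Q (I without j) (z -ᶻ proj₁ σ j)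
  LatticeSplit-remove {I} {z} j (b , b∈ , b≈0 , z≈) = b′ , b′∈ , b′≈0 , z-bj≈
    where
    b′ : Fin m → Vecℤ d
    b′ i = b i -ᶻ onlyAt j (b j) i
    b′i≈bi : ∀ i → i ≢ j → b′ i ≈ᶻ b i
    b′i≈bi i i≢j k = trans (cong (λ v → b i k ℤ.- v k) (onlyAt-off (b j) i≢j)) (ℤP.+-identityʳ (b i k))
    b′∈ : ∀ i → T ((I without j) i) → LatPts (Q i) (b′ i)
    b′∈ i i∈I′ with i ≟ j
    ... | yes refl = ⊥-elim (subst T (without-diag I j) i∈I′)
    ... | no i≢j = Q-resp i (λ k → cong (ℚ._/ 1) (sym (b′i≈bi i i≢j k))) (b∈ i (subst T (without-off I i≢j) i∈I′))
    b′≈0 : ∀ i → T (not ((I without j) i)) → b′ i ≈ᶻ 0ᶻ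
    b′≈0 i i∉I′ with i ≟ j
    ... | yes refl = λ k → trans (cong (λ v → b j k ℤ.- v k) (onlyAt-diag j (b j))) (ℤP.+-inverseʳ (b j k))
    ... | no i≢j = λ k → trans (b′i≈bi i i≢j k) (b≈0 i (subst (T ∘ not) (without-off I i≢j) i∉I′) k)
    z≈b′+bj : toℚ z ≈ᵥ (toℚ (sumᶻ b′) +ᵥ toℚ (b j))
    z≈b′+bj k = begin
      toℚ z k
        ≡⟨ cong (ℚ._/ 1) (z≈ k) ⟩
      toℚ (sumᶻ b) k
        ≡⟨ cong (ℚ._/ 1) (sumᶻ-cong (λ i k′ → [-ᶻ]-+ᶻ (b i) (onlyAt j (b j) i) k′) k) ⟩
      toℚ (sumᶻ (λ i → b′ i +ᶻ onlyAt j (b j) i)) k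
        ≡⟨ sum-+-onlyAt b′ j (b j) k ⟩
      toℚ (sumᶻ b′) k + toℚ (b j) k ∎
      where open ≡-Reasoning
    z-bj≈ : (z -ᶻ b j) ≈ᶻ sumᶻ b′
    z-bj≈ = toℚ-injective (z -ᶻ b j) (sumᶻ b′) (toℚ-[-ᶻ] z (b j) z≈b′+bj)

module _ {m N : ℕ} (P : Fin m → List (Vecℤ N)) (n : Fin m → ℕ) (n≥1 : ∀ i → 1 ℕ.≤ n i) where

  private
    CS = Cayley (Q P n)
    Q-resp : ∀ i → Respects≈ (Q P n i)
    Q-resp i = ⊙-resp-≈ (n i) (LatticePolytope (P i))

  Cayley-lattice-generator : ∀ B → LatPts CS B →
    ∃ λ j → B (j ↑ˡ N) ≡ ℤ.+ 1 × (∀ i → i ≢ j → B (i ↑ˡ N) ≡ ℤ.+ 0) × LatPts (Q P n j) (drop m B)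
  Cayley-lattice-generator B B∈ =
    j , trans (take≡ j) (cong (λ a → ℤ.+ a) aj≡1) , (λ i i≢j → trans (take≡ i) (cong (λ a → ℤ.+ a) (others i i≢j))) , drop∈Q
    where
    open CayleyLattice (⊙Cayley⇒CayleyLattice P n 1 B (toℚ B , B∈ , λ k → sym (ℚP.*-identityˡ (toℚ B k))))
    unit = sumℕ≡1⇒unit mult mult-sum
    j = proj₁ unit
    aj≡1 = proj₁ (proj₂ unit)
    others = proj₂ (proj₂ unit)
    open ConeSum drop∈
    parts≈0 : ∀ i → i ≢ j → parts i ≈ᵥ 0ᵥ
    parts≈0 i i≢j = Cone-weight-0 (Cone-resp-weight (cong (λ a → ℕtoℚ (a ℕ.* n i)) (others i i≢j)) (parts∈ i))
    drop∈Q : LatPts (Q P n j) (drop m B)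
    drop∈Q = Q-resp j (≈ᵥ-sym (≈ᵥ-trans sum-parts (sumᵥ-single parts j parts≈0)))
               (Cone⇒⊙Conv (n j) (n≥1 j) (Cone-resp-weight (cong ℕtoℚ (trans (cong (ℕ._* n j) aj≡1) (ℕP.*-identityˡ (n j)))) (parts∈ j)))

  module _ (idp : IDP CS) where

    Cayley-split : ∀ s X I → (∀ i → X (i ↑ˡ N) ≡ ℤ.+ 𝟙 (I i)) → LatPts (s ⊙ CS) X → LatticeSplit (Q P n) I (drop m X)
    Cayley-split zero X I take≡ (u , _ , X≈0u) =
      (λ _ → 0ᶻ) ,
      (λ i i∈I → ⊥-elim (T-not⇒¬T (𝟙≡0⇒false (I i) (ℤP.+-injective (trans (sym (take≡ i)) (X≡0 (i ↑ˡ N))))) i∈I)) ,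
      (λ _ _ _ → refl) , λ k → trans (X≡0 (m ↑ʳ k)) (sym (toℚ-injective (sumᶻ {m} (λ _ → 0ᶻ)) 0ᶻ (sumᶻ≈0 {m}) k))
      where
      X≡0 : ∀ ι → X ι ≡ ℤ.+ 0
      X≡0 ι = /1-injective (X ι) (ℤ.+ 0) (trans (X≈0u ι) (ℚP.*-zeroˡ (u ι)))
      sumᶻ≈0 : ∀ {k} → toℚ (sumᶻ {k} {N} (λ _ → 0ᶻ)) ≈ᵥ toℚ 0ᶻ
      sumᶻ≈0 {k} = ≈ᵥ-trans (toℚ-sumᶻ {k} (λ _ → 0ᶻ)) (sumᵥ-zero {k})
    Cayley-split (suc s) X I take≡ X∈ =
      LatticeSplit-resp-≈ᶻ Q-resp {I} {drop m A +ᶻ drop m B} {drop m X} (λ k → sym (X≈A+B (m ↑ʳ k)))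
        (LatticeSplit-insert Q-resp {I} {drop m A} {drop m B} j (proj₁ removed) B-drop∈Q (Cayley-split s A (I without j) A-take≡ A∈))
      where
      decomposition : ∃[ A ] ∃[ B ] (LatPts (s ⊙ CS) A × LatPts CS B × X ≈ᶻ (A +ᶻ B))
      decomposition = Equivalence.to (idp (suc s) (ℕ.s≤s ℕ.z≤n) X) X∈
      A B : Vecℤ (m ℕ.+ N)
      A = proj₁ decomposition
      B = proj₁ (proj₂ decomposition)
      A∈ : LatPts (s ⊙ CS) A
      A∈ = proj₁ (proj₂ (proj₂ decomposition))
      B∈ : LatPts CS B
      B∈ = proj₁ (proj₂ (proj₂ (proj₂ decomposition)))
      X≈A+B : X ≈ᶻ (A +ᶻ B)
      X≈A+B = proj₂ (proj₂ (proj₂ (proj₂ decomposition)))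
      generator = Cayley-lattice-generator B B∈
      j : Fin m
      j = proj₁ generator
      Bj≡1 : B (j ↑ˡ N) ≡ ℤ.+ 1
      Bj≡1 = proj₁ (proj₂ generator)
      Bi≡0 : ∀ i → i ≢ j → B (i ↑ˡ N) ≡ ℤ.+ 0
      Bi≡0 = proj₁ (proj₂ (proj₂ generator))
      B-drop∈Q : LatPts (Q P n j) (drop m B)
      B-drop∈Q = proj₂ (proj₂ (proj₂ generator))
      open CayleyLattice (⊙Cayley⇒CayleyLattice P n s A A∈) renaming (take≡ to A-take≡ℕ)
      take-sum : ∀ i → ℤ.+ 𝟙 (I i) ≡ ℤ.+ mult i ℤ.+ B (i ↑ˡ N)
      take-sum i = trans (sym (take≡ i)) (trans (X≈A+B (i ↑ˡ N)) (cong (ℤ._+ B (i ↑ˡ N)) (A-take≡ℕ i)))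
      removed : T (I j) × (∀ i → mult i ≡ 𝟙 ((I without j) i))
      removed = 𝟙-without I mult j
        (trans (ℤP.+-injective (trans (take-sum j) (cong (ℤ._+_ (ℤ.+ mult j)) Bj≡1))) (ℕP.+-comm (mult j) 1))
        (λ i i≢j → trans (ℤP.+-injective (trans (take-sum i) (cong (ℤ._+_ (ℤ.+ mult i)) (Bi≡0 i i≢j)))) (ℕP.+-identityʳ (mult i)))
      A-take≡ : ∀ i → A (i ↑ˡ N) ≡ ℤ.+ 𝟙 ((I without j) i)
      A-take≡ i = trans (A-take≡ℕ i) (cong (λ a → ℤ.+ a) (proj₂ removed i))

    Cayley-IDP⇒TupleIDP : TupleIDP (Q P n)
    Cayley-IDP⇒TupleIDP I (j , j∈I) z = mk⇔ split (LatticeSplit⇒MinkSumOver Q-resp)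
      where
      split : LatPts (MinkSumOver I (Q P n)) z → LatticeSplit (Q P n) I z
      split z∈ = LatticeSplit-resp-≈ᶻ Q-resp (λ k → lookup-++ʳ (λ i → ℤ.+ 𝟙 (I i)) z k)
                   (Cayley-split (sumℕ (𝟙 ∘ I)) X I (λ i → lookup-++ˡ (λ i → ℤ.+ 𝟙 (I i)) z i) X∈)
        where
        X = (λ i → ℤ.+ 𝟙 (I i)) ++ z
        s≥1 : 1 ℕ.≤ sumℕ (𝟙 ∘ I)
        s≥1 = subst (ℕ._≤ sumℕ (𝟙 ∘ I)) (T⇒𝟙≡1 j∈I) (aᵢ≤sumℕ (𝟙 ∘ I) j)
        X∈ : LatPts (sumℕ (𝟙 ∘ I) ⊙ CS) X
        X∈ = CayleyLattice⇒⊙Cayley P n n≥1 (sumℕ (𝟙 ∘ I)) s≥1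
               (cayleyLattice {X = X} (𝟙 ∘ I) (λ i → lookup-++ˡ (λ i → ℤ.+ 𝟙 (I i)) z i) refl
                              (ConeSum-resp-≈ (λ k → cong (ℚ._/ 1) (sym (lookup-++ʳ (λ i → ℤ.+ 𝟙 (I i)) z k))) (MinkSumOver⇒ΣDilates P n z∈)))

  module _ (dim : ∀ i → DimAtMost (LatticePolytope (P i)) (n i)) (tuple : TupleIDP (Q P n)) where

    Cayley-IDPStep : ∀ c → IDPStep CS c
    Cayley-IDPStep c X = mk⇔ to from
      where
      from : ∃[ A ] ∃[ B ] (LatPts (suc c ⊙ CS) A × LatPts CS B × X ≈ᶻ (A +ᶻ B)) → LatPts (suc (suc c) ⊙ CS) X
      from (A , B , A∈ , B∈ , X≈A+B) =
        ⊙-resp-≈ (suc (suc c)) CS (λ k → sym (trans (cong (ℚ._/ 1) (X≈A+B k)) (toℚ-+ᶻ A B k)))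
          (⊙Conv-+ (CayleyGenerators P n) c A∈ B∈)
      to : LatPts (suc (suc c) ⊙ CS) X → ∃[ A ] ∃[ B ] (LatPts (suc c ⊙ CS) A × LatPts CS B × X ≈ᶻ (A +ᶻ B))
      to X∈ = X -ᶻ B , B , A∈ , B∈ , [-ᶻ]-+ᶻ X B
        where
        open CayleyLattice (⊙Cayley⇒CayleyLattice P n (suc (suc c)) X X∈) renaming (mult to a)
        open Peeled (ΣDilates-peel P n dim a drop∈) renaming (lattice-part to r)
        I : Fin m → Bool
        I = nonzero? ∘ a
        y : Vecℤ N
        y = drop m X -ᶻ r
        y∈ : LatPts (MinkSumOver I (Q P n)) y
        y∈ = ΣDilates⇒MinkSumOver P n n≥1 (ConeSum-resp-≈ (≈ᵥ-sym (toℚ-[-ᶻ] (drop m X) r split)) rest∈)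
        nonzero : ∃ λ j → ∃ λ t → a j ≡ suc t
        nonzero = sumℕ≡suc⇒nonzero a mult-sum
        j : Fin m
        j = proj₁ nonzero
        aj≡ : a j ≡ suc (proj₁ (proj₂ nonzero))
        aj≡ = proj₂ (proj₂ nonzero)
        j∈I : T (I j)
        j∈I = subst (T ∘ nonzero?) (sym aj≡) tt
        σ : LatticeSplit (Q P n) I y
        σ = Equivalence.to (tuple I (j , j∈I) y) y∈
        b : Fin m → Vecℤ N
        b = proj₁ σ
        B : Vecℤ (m ℕ.+ N)
        B = unitVecᶻ j ++ b j
        B∈ : LatPts CS B
        B∈ = unitVecᶻ-++∈Cayley P n j (proj₁ (proj₂ σ) j j∈I)
        a′ : Fin m → ℕ
        a′ = updateAt a j ℕ.pred
        A-take≡ : ∀ i → (X -ᶻ B) (i ↑ˡ N) ≡ ℤ.+ a′ i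
        A-take≡ i = trans (cong₂ ℤ._-_ (take≡ i) (lookup-++ˡ (unitVecᶻ j) (b j) i)) (pos-minus-unitVecᶻ j a aj≡ i)
        A-drop≈ : (toℚ r +ᵥ toℚ (y -ᶻ b j)) ≈ᵥ toℚ (drop m (X -ᶻ B))
        A-drop≈ k =
          trans (sym (toℚ-+ᶻ r (y -ᶻ b j) k))
                (cong (ℚ._/ 1) (trans rearrange (cong (ℤ._-_ (X (m ↑ʳ k))) (sym (lookup-++ʳ (unitVecᶻ j) (b j) k)))))
          where
          rearrange : r k ℤ.+ ((X (m ↑ʳ k) ℤ.- r k) ℤ.- b j k) ≡ X (m ↑ʳ k) ℤ.- b j k
          rearrange = ℤSolver.solve 3 (λ r x q → r ℤSolver.:+ ((x ℤSolver.:- r) ℤSolver.:- q) ℤSolver.:= x ℤSolver.:- q)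
                                      refl (r k) (X (m ↑ʳ k)) (b j k)
        A-drop∈ : ΣDilates P n a′ (toℚ (drop m (X -ᶻ B)))
        A-drop∈ = ConeSum-resp-≈ A-drop≈
                    (ΣDilates-resp-mult P n {k = λ i → ℕ.pred (a i) ℕ.+ 𝟙 ((I without j) i)} {k′ = a′} (pred+𝟙-without a j)
                      (ΣDilates-+ P n {k = ℕ.pred ∘ a} {k′ = 𝟙 ∘ (I without j)} lattice-part∈
                        (MinkSumOver⇒ΣDilates P n (LatticeSplit⇒MinkSumOver Q-resp (LatticeSplit-remove Q-resp j σ)))))
        A∈ : LatPts (suc c ⊙ CS) (X -ᶻ B)
        A∈ = CayleyLattice⇒⊙Cayley P n n≥1 (suc c) (ℕ.s≤s ℕ.z≤n) {X -ᶻ B}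
               (cayleyLattice a′ A-take≡ (ℕP.suc-injective (trans (sumℕ-updateAt-pred a j aj≡) mult-sum)) A-drop∈)

    Cayley-IDP : IDP CS
    Cayley-IDP = IDP-intro CS (Conv-resp-≈ (CayleyGenerators P n)) Cayley-IDPStep

corollary2p3 : (m N : ℕ) (P : Fin m → List (Vecℤ N)) (n : Fin m → ℕ) →
    (∀ i → 1 ℕ.≤ n i) → (∀ i → DimAtMost (LatticePolytope (P i)) (n i)) →
    IDP (MinkSum (λ i → n i ⊙ LatticePolytope (P i)))
      × (IDP (Cayley (λ i → n i ⊙ LatticePolytope (P i)))
          ⇔ TupleIDP (λ i → n i ⊙ LatticePolytope (P i)))
corollary2p3 m N P n n≥1 dim =
  MinkSum-IDP P n n≥1 dim , mk⇔ (Cayley-IDP⇒TupleIDP P n n≥1) (Cayley-IDP P n n≥1 dim)
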